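{- Let $G$ be a weighted $($not necessarily planar$)$ graph. Let $a$, $b$, $c$ and $d$ be four arbitrary, distinct vertices of $G$. Assume that for all two-element subsets $S\subset\{a,b,c,d\}$, all paths connecting $a$ to $b$, $a$ to $c$, or $b$ to $c$ that arise from the superposition of any perfect matching $\mu$ of $G\setminus S$ with any perfect matching $\nu$ of $G\setminus\overline{S}$ have odd length, where $\overline{S}$ denotes the complement of $S$ in $\{a,b,c,d\}$. Then \begin{align*} &\operatorname{M}(G)\operatorname{M}(G\setminus\{a,b,c,d\}) = \operatorname{M}(G\setminus\{a,b\})\operatorname{M}(G\setminus\{c,d\}) + \operatorname{M}(G\setminus\{a,c\})\operatorname{M}(G\setminus\{b,d\}) \\ &\qquad\qquad+ \operatorname{M}(G\setminus\{a,d\})\operatorname{M}(G\setminus\{b,c\}). \end{align*}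
   Context: For a graph $G$ with weights on its edges, $\operatorname{M}(G)$ denotes the sum of the weights of all perfect matchings of $G$, where the weight of a matching is the product of the weights of its edges. -}

module Defs where

open import Level using (Level)
open import Data.Bool using (Bool; true; false; _∧_; not; if_then_else_)
open import Data.Nat using (ℕ; zero; suc; _*_; _<ᵇ_)
open import Data.Fin using (Fin; toℕ)
open import Data.Fin.Properties using (_≟_)
open import Data.Fin.Subset using (Subset)
open import Data.List using (List; []; _∷_; map; concatMap; foldr)
open import Data.Bool.ListAction using (and)
open import Data.List.Relation.Unary.Linked using (Linked)
open import Data.List.Relation.Unary.Unique.Propositional using (Unique)
open import Data.Vec using (Vec; []; _∷_; lookup; head; last; toList; allFin)
open import Data.Product using (_×_; ∃)
open import Data.Sum using (_⊎_)
open import Relation.Nullary.Decidable using (⌊_⌋)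
open import Relation.Binary.PropositionalEquality using (_≡_; _≢_)
open import Algebra.Bundles using (CommutativeRing)

-- The weight of the (unordered) edge {u,v} with
-- toℕ u < toℕ v is  weight u v  (values of weight on other pairs are irrelevant).
record WGraph {c ℓ : Level} (R : CommutativeRing c ℓ) (n : ℕ) : Set c where
  field
    adj     : Fin n → Fin n → Bool
    adj-sym : ∀ u v → adj u v ≡ adj v u
    adj-irr : ∀ v → adj v v ≡ false
    weight  : Fin n → Fin n → CommutativeRing.Carrier R
open WGraph public

allVecs : (k m : ℕ) → List (Vec (Fin k) m)
allVecs k zero    = [] ∷ []
allVecs k (suc m) = concatMap (λ i → map (i ∷_) (allVecs k m)) (toList (allFin k))

_==_ : {n : ℕ} → Fin n → Fin n → Bool
u == v = ⌊ u ≟ v ⌋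

-- A matching is encoded as its partner map m : Fin n → Fin n (as a vector).
-- isPM G D m : m is a perfect matching of G ∖ D (D = set of deleted vertices):
--   deleted vertices are fixed by m; every remaining vertex v has a partner
--   m v ≠ v which is not deleted, m (m v) = v, and {v, m v} is an edge of G.
isPM : {c ℓ : Level} {R : CommutativeRing c ℓ} {n : ℕ} →
       WGraph R n → Subset n → Vec (Fin n) n → Bool
isPM {n = n} G D m = and (map check (toList (allFin n)))
  where
  check : Fin n → Bool
  check v = if lookup D v
            then lookup m v == v
            else (not (lookup D (lookup m v)) ∧ not (lookup m v == v)
                  ∧ (lookup m (lookup m v) == v) ∧ adj G v (lookup m v))

-- Weight of a matching of G ∖ D: product of the weights of its edges
-- (each edge {v, m v} counted once, from its smaller endpoint).
matchWeight : {c ℓ : Level} (R : CommutativeRing c ℓ) {n : ℕ} →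
              WGraph R n → Subset n → Vec (Fin n) n → CommutativeRing.Carrier R
matchWeight R {n} G D m = foldr _*R_ 1# (map f (toList (allFin n)))
  where
  open CommutativeRing R renaming (_*_ to _*R_)
  f : Fin n → Carrier
  f v = if (not (lookup D v) ∧ (toℕ v <ᵇ toℕ (lookup m v)))
        then weight G v (lookup m v) else 1#

M : {c ℓ : Level} (R : CommutativeRing c ℓ) {n : ℕ} →
    WGraph R n → Subset n → CommutativeRing.Carrier R
M R {n} G D = foldr _+_ 0#
  (map (λ m → if isPM G D m then matchWeight R G D m else 0#) (allVecs n n))
  where open CommutativeRing R

SupAdj : {n : ℕ} → Vec (Fin n) n → Vec (Fin n) n → Fin n → Fin n → Set
SupAdj μ ν u v = (lookup μ u ≡ v × u ≢ v) ⊎ (lookup ν u ≡ v × u ≢ v)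

SupPath : {n : ℕ} → Vec (Fin n) n → Vec (Fin n) n → Fin n → Fin n →
          (k : ℕ) → Vec (Fin n) (suc k) → Set
SupPath μ ν x y k p =
  head p ≡ x × last p ≡ y × Unique (toList p) × Linked (SupAdj μ ν) (toList p)

Odd : ℕ → Set
Odd k = ∃ λ j → k ≡ suc (2 * j)

module Submission where

-- Superimposing a perfect matching μ of G with a perfect matching ν of G ∖ {a, b, c, d}, the
-- vertices a, b, c, d have degree one and all others degree zero or two, so the component of a
-- is a path ending at b, c or d. This splits M(G) M(G ∖ {a,b,c,d}) into three sums. Exchanging
-- μ and ν along the path from a to x turns (μ, ν) into perfect matchings of G ∖ {a, x} and of
-- G ∖ {y, z}, where {y, z} = {b, c, d} ∖ {x}, without changing the product of the weights.
-- Conversely, for such a pair the path from a must end at x: a path between a vertex deleted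
-- in one matching and a vertex deleted in the other starts and ends with edges of different
-- matchings, so it has even length, which the hypothesis forbids for the pairs that could
-- otherwise occur. Hence exchange is an involution matching the x-th sum with the x-th product.

open import Defs
open import Level using (Level)
open import Function using (_∘_; case_of_)
open import Data.Bool using (Bool; true; false; _∧_; _∨_; not; if_then_else_)
open import Data.Bool.Properties
  using (∨-identityʳ; ∨-zeroʳ; ∨-assoc; ∨-comm; ∨-commutativeMonoid; ∧-identityʳ; ∧-assoc)
open import Data.Bool.ListAction using (and)
open import Data.Nat using (ℕ; zero; suc; _<ᵇ_)
open import Data.Fin using (Fin; zero; suc; toℕ)
open import Data.Fin.Properties using () renaming (_≟_ to _≟ᶠ_)
open import Data.Fin.Subset using (Subset; ⁅_⁆; _∪_; _∩_; ∁; _⊆_; ∣_∣) renaming (⊥ to ∅)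
open import Data.Fin.Subset.Properties using (x∈⁅x⁆; x∈⁅y⁆⇒x≡y; ∣⁅x⁆∣≡1; ∪-identityˡ; ∪-identityʳ)
open import Data.Vec using (Vec; []; _∷_; tabulate; toList; allFin; lookup)
open import Data.Vec.Properties
  using (lookup∘tabulate; tabulate-cong; tabulate∘lookup; lookup-replicate; lookup-zipWith; lookup-map;
         []=⇒lookup; lookup⇒[]=; ∷-injective)
  renaming (≡-dec to ≡-decⱽ)
open import Data.Vec.Relation.Binary.Pointwise.Extensional using (ext; Pointwise-≡⇒≡)
open import Data.List using (List; map)
open import Data.Product using (_×_; _,_; proj₁; proj₂)
open import Data.Product.Properties using (,-injective) renaming (≡-dec to ≡-decˣ)
open import Data.Sum using (_⊎_; inj₁; inj₂)
import Data.Sum as Sum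
open import Data.Empty using (⊥; ⊥-elim)
open import Relation.Nullary using (¬_; Dec; yes; no)
open import Relation.Binary.PropositionalEquality as ≡
open import Algebra.Bundles using (CommutativeRing; CommutativeMonoid)
open import Algebra.Properties.CommutativeSemigroup (CommutativeMonoid.commutativeSemigroup ∨-commutativeMonoid)
  using () renaming (interchange to ∨-interchange)


module AlternatingWalks where

  open import Data.Bool.Properties using (not-involutive; not-injective; not-¬; ¬-not) renaming (_≟_ to _≟ᵇ_)
  open import Data.Nat using (_<_; _≤_; z≤n; s≤s; z<s; _+_; _∸_)
  open import Data.Nat.Properties
  open import Data.Fin.Properties using (pigeonhole; toℕ≤pred[n])
  open import Data.Product using (∃)
  open import Data.Vec using (head; last)
  import Data.List as List
  open import Data.List.Relation.Unary.All using (All; []; _∷_)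
  open import Data.List.Relation.Unary.AllPairs using ([]; _∷_)
  open import Data.List.Relation.Unary.Linked as Linked using (Linked; [-]; _∷_)
  open import Data.List.Relation.Unary.Unique.Propositional using (Unique)
  open import Relation.Binary.Definitions using (tri<; tri≈; tri>)

  module _ {n : ℕ} {u v : Fin n} where

    ==⇒≡ : (u == v) ≡ true → u ≡ v
    ==⇒≡ e with u ≟ᶠ v
    ... | yes u≡v = u≡v
    ==⇒≡ () | no _

    ≡⇒== : u ≡ v → (u == v) ≡ true
    ≡⇒== u≡v with u ≟ᶠ v
    ... | yes _   = refl
    ... | no u≢v = ⊥-elim (u≢v u≡v)

    ≢⇒== : u ≢ v → (u == v) ≡ false
    ≢⇒== u≢v with u ≟ᶠ v
    ... | yes u≡v = ⊥-elim (u≢v u≡v)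
    ... | no _    = refl

    ==⇒≢ : (u == v) ≡ false → u ≢ v
    ==⇒≢ e u≡v = case trans (sym (≡⇒== u≡v)) e of λ ()

  isEven : ℕ → Bool
  isEven zero    = true
  isEven (suc i) = not (isEven i)

  isEven-+ : ∀ i j → isEven (i + j) ≡ (if isEven i then isEven j else not (isEven j))
  isEven-+ zero    j = refl
  isEven-+ (suc i) j rewrite isEven-+ i j with isEven i | isEven j
  ... | true  | _ = refl
  ... | false | b = not-involutive b

  isEven-odd : ∀ k → Odd k → isEven k ≡ false
  isEven-odd k (j , refl) =
    cong not (trans (isEven-+ j (j + 0)) (double (isEven j) (isEven (j + 0)) (cong isEven (+-identityʳ j))))
    where
    double : ∀ b c → c ≡ b → (if b then c else not c) ≡ true
    double true  c c≡b = c≡b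
    double false c c≡b = cong not c≡b

  -- The least index in [i, i + fuel) at which p holds, or i + fuel if there is none.
  firstFrom : (ℕ → Bool) → ℕ → ℕ → ℕ
  firstFrom p i zero       = i
  firstFrom p i (suc fuel) = if p i then i else firstFrom p (suc i) fuel

  firstFrom-least : (p : ℕ → Bool) → ∀ fuel i t →
    (∀ u → u < i → p u ≡ false) → p t ≡ true → t < i + fuel →
    p (firstFrom p i fuel) ≡ true × (∀ u → u < firstFrom p i fuel → p u ≡ false)
  firstFrom-least p zero i t below pt t< =
    case trans (sym pt) (below t (subst (t <_) (+-identityʳ i) t<)) of λ ()
  firstFrom-least p (suc fuel) i t below pt t< with p i in pi
  ... | true  = pi , below
  ... | false = firstFrom-least p fuel (suc i) t below′ pt (subst (t <_) (+-suc i fuel) t<)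
    where
    below′ : ∀ u → u < suc i → p u ≡ false
    below′ u u<1+i with m≤n⇒m<n∨m≡n (≤-pred u<1+i)
    ... | inj₁ u<i  = below u u<i
    ... | inj₂ refl = pi

  least-unique : (p : ℕ → Bool) → ∀ k k′ →
    p k ≡ true → (∀ u → u < k → p u ≡ false) →
    p k′ ≡ true → (∀ u → u < k′ → p u ≡ false) → k ≡ k′
  least-unique p k k′ pk below pk′ below′ with <-cmp k k′
  ... | tri≈ _ k≡k′ _ = k≡k′
  ... | tri< k<k′ _ _ = case trans (sym pk) (below′ k k<k′) of λ ()
  ... | tri> _ _ k′<k = case trans (sym pk′) (below k′ k′<k) of λ ()

  module _ {n : ℕ} (W : ℕ → Fin n) where

    visits : ℕ → Fin n → Bool
    visits zero    v = W zero == v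
    visits (suc m) v = (W (suc m) == v) ∨ visits m v

    visits-intro : ∀ m i → i ≤ m → visits m (W i) ≡ true
    visits-intro zero    zero    _   = ≡⇒== refl
    visits-intro (suc m) i       i≤m with m≤n⇒m<n∨m≡n i≤m
    ... | inj₂ refl rewrite ≡⇒== {u = W i} refl = refl
    ... | inj₁ i<m rewrite visits-intro m i (≤-pred i<m) with W (suc m) == W i
    ...   | true  = refl
    ...   | false = refl

    visits-elim : ∀ m v → visits m v ≡ true → ∃ λ i → i ≤ m × W i ≡ v
    visits-elim zero    v e = zero , z≤n , ==⇒≡ e
    visits-elim (suc m) v e with W (suc m) == v in eq
    ... | true  = suc m , ≤-refl , ==⇒≡ eq
    ... | false with visits-elim m v e
    ...   | i , i≤m , Wi≡v = i , m≤n⇒m≤1+n i≤m , Wi≡v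

    segment : ℕ → (m : ℕ) → Vec (Fin n) (suc m)
    segment i zero    = W i ∷ []
    segment i (suc m) = W i ∷ segment (suc i) m

    segment-head : ∀ i m → head (segment i m) ≡ W i
    segment-head i zero    = refl
    segment-head i (suc m) = refl

    segment-last : ∀ i m → last (segment i m) ≡ W (i + m)
    segment-last i zero    = cong W (sym (+-identityʳ i))
    segment-last i (suc m) = trans (segment-last (suc i) m) (cong W (sym (+-suc i m)))

    segment-all : (P : Fin n → Set) → ∀ i m →
      (∀ j → i ≤ j → j ≤ i + m → P (W j)) → All P (toList (segment i m))
    segment-all P i zero    h = h i ≤-refl (m≤m+n i 0) ∷ []
    segment-all P i (suc m) h =
      h i ≤-refl (m≤m+n i (suc m)) ∷
      segment-all P (suc i) m (λ j i<j j≤ → h j (<⇒≤ i<j) (subst (j ≤_) (sym (+-suc i m)) j≤))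

    segment-unique : ∀ i m → (∀ p q → i ≤ p → p < q → q ≤ i + m → W p ≢ W q) →
      Unique (toList (segment i m))
    segment-unique i zero    h = [] ∷ []
    segment-unique i (suc m) h =
      segment-all (W i ≢_) (suc i) m (λ j i<j j≤ → h i j ≤-refl i<j (subst (j ≤_) (sym (+-suc i m)) j≤)) ∷
      segment-unique (suc i) m (λ p q i<p p<q q≤ → h p q (<⇒≤ i<p) p<q (subst (q ≤_) (sym (+-suc i m)) q≤))

    segment-linked : (R : Fin n → Fin n → Set) → ∀ i m →
      (∀ j → i ≤ j → j < i + m → R (W j) (W (suc j))) → Linked R (toList (segment i m))
    segment-linked R i zero    h = [-]
    segment-linked R i (suc m) h =
      cons (h i ≤-refl (subst (i <_) (sym (+-suc i m)) (s≤s (m≤m+n i m))))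
           (segment-linked R (suc i) m (λ j i<j j< → h j (<⇒≤ i<j) (subst (j <_) (sym (+-suc i m)) j<)))
      where
      cons : ∀ {m′} → R (W i) (W (suc i)) → Linked R (toList (segment (suc i) m′)) →
             Linked R (W i List.∷ toList (segment (suc i) m′))
      cons {zero}   r l = r ∷ l
      cons {suc m′} r l = r ∷ l

  visits-cong : {n : ℕ} (W W′ : ℕ → Fin n) (v : Fin n) → ∀ m →
    (∀ i → i ≤ m → W i ≡ W′ i) → visits W m v ≡ visits W′ m v
  visits-cong W W′ v zero    h = cong (_== v) (h zero z≤n)
  visits-cong W W′ v (suc m) h =
    cong₂ _∨_ (cong (_== v) (h (suc m) ≤-refl)) (visits-cong W W′ v m (λ i i≤m → h i (m≤n⇒m≤1+n i≤m)))

  -- Alternating σ and τ from s. For two matchings given as partner maps this traces the path of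
  -- their superposition that starts at s, which ends at the first step that does not move.
  module Walk {n : ℕ} (σ τ : Fin n → Fin n) (s : Fin n) where

    step : ℕ → Fin n → Fin n
    step i = if isEven i then σ else τ

    walk : ℕ → Fin n
    walk zero    = s
    walk (suc i) = step i (walk i)

    stopsAt : ℕ → Bool
    stopsAt i = walk (suc i) == walk i

    stopTime : ℕ
    stopTime = firstFrom stopsAt 0 n

    end : Fin n
    end = walk stopTime

    onWalk : Fin n → Bool
    onWalk = visits walk stopTime

    path : Vec (Fin n) (suc stopTime)
    path = segment walk 0 stopTime

  -- For σ = lookup μ and τ = lookup ν this is SupAdj μ ν.
  Moves : {n : ℕ} → (Fin n → Fin n) → (Fin n → Fin n) → Fin n → Fin n → Set
  Moves σ τ u v = (σ u ≡ v × u ≢ v) ⊎ (τ u ≡ v × u ≢ v)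

  IsPath : {n k : ℕ} → (Fin n → Fin n) → (Fin n → Fin n) → Fin n → Fin n → Vec (Fin n) (suc k) → Set
  IsPath σ τ v w p = head p ≡ v × last p ≡ w × Unique (toList p) × Linked (Moves σ τ) (toList p)

  IsPath-swap : {n k : ℕ} {σ τ : Fin n → Fin n} {v w : Fin n} {p : Vec (Fin n) (suc k)} →
    IsPath σ τ v w p → IsPath τ σ v w p
  IsPath-swap (h , l , u , linked) = h , l , u , Linked.map Sum.swap linked

  module Through {n : ℕ} (σ τ : Fin n → Fin n) (v : Fin n) where

    σ₀ τ₀ : Fin n → Fin n
    σ₀ = if τ v == v then σ else τ
    τ₀ = if τ v == v then τ else σ

    open Walk σ₀ τ₀ v public

  partner : {n : ℕ} → (Fin n → Fin n) → (Fin n → Fin n) → Fin n → Fin n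
  partner σ τ v = Through.end σ τ v

  DegreeOne : {n : ℕ} → (Fin n → Fin n) → (Fin n → Fin n) → Fin n → Set
  DegreeOne σ τ v = (τ v ≡ v × σ v ≢ v) ⊎ (σ v ≡ v × τ v ≢ v)

  FixedByDifferent : {n : ℕ} → (Fin n → Fin n) → (Fin n → Fin n) → Fin n → Fin n → Set
  FixedByDifferent σ τ v w = (τ v ≡ v × σ w ≡ w) ⊎ (σ v ≡ v × τ w ≡ w)

  record PartnerFacts {n : ℕ} (σ τ : Fin n → Fin n) (v w : Fin n) : Set where
    field
      degreeOne  : DegreeOne σ τ w
      moves      : w ≢ v
      involutive : partner σ τ w ≡ v
      length     : ℕ
      vertices   : Vec (Fin n) (suc length)
      isPath     : IsPath σ τ v w vertices
      even       : FixedByDifferent σ τ v w → isEven length ≡ true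

  partner-τ : ∀ {n} {σ τ : Fin n → Fin n} {v} → τ v ≡ v → partner σ τ v ≡ Walk.end σ τ v
  partner-τ τv≡v rewrite ≡⇒== τv≡v = refl

  partner-σ : ∀ {n} {σ τ : Fin n → Fin n} {v} → τ v ≢ v → partner σ τ v ≡ Walk.end τ σ v
  partner-σ τv≢v rewrite ≢⇒== τv≢v = refl

  partner-swap : ∀ {n} {σ τ : Fin n → Fin n} {v} → DegreeOne σ τ v → partner τ σ v ≡ partner σ τ v
  partner-swap (inj₁ (τv≡v , σv≢v)) rewrite ≡⇒== τv≡v | ≢⇒== σv≢v = refl
  partner-swap (inj₂ (σv≡v , τv≢v)) rewrite ≡⇒== σv≡v | ≢⇒== τv≢v = refl

  PartnerFacts-swap : ∀ {n} {σ τ : Fin n → Fin n} {v w} → PartnerFacts τ σ v w → PartnerFacts σ τ v w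
  PartnerFacts-swap {σ = σ} {τ} f = record
    { degreeOne = Sum.swap degreeOne ; moves = moves
    ; involutive = trans (partner-swap {σ = τ} {τ = σ} degreeOne) involutive
    ; length = length ; vertices = vertices ; isPath = IsPath-swap isPath ; even = even ∘ Sum.swap }
    where open PartnerFacts f

  module WalkProperties {n : ℕ} (σ τ : Fin n → Fin n)
    (σ-inv : ∀ v → σ (σ v) ≡ v) (τ-inv : ∀ v → τ (τ v) ≡ v) {s : Fin n} (τs≡s : τ s ≡ s) where

    open Walk σ τ s

    step-inv : ∀ i v → step i (step i v) ≡ v
    step-inv i v with isEven i
    ... | true  = σ-inv v
    ... | false = τ-inv v

    step-cong : ∀ i j → isEven i ≡ isEven j → ∀ v → step i v ≡ step j v
    step-cong i j e v = cong (λ b → (if b then σ else τ) v) e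

    Stop : ℕ → Set
    Stop t = walk (suc t) ≡ walk t

    -- A repetition walk i ≡ walk j is pushed inwards (equal parity: one step forward from i;
    -- opposite parity: one step backward from j) until it becomes a stop, or reaches the start,
    -- where τ s ≡ s turns it into a repetition of s.
    repeat⇒stop : ∀ j i → i < j → walk i ≡ walk j → ∃ λ t → t < j × Stop t
    repeat⇒stop zero i () _
    repeat⇒stop (suc j) i i<1+j Wi≡W1+j with isEven i ≟ᵇ isEven j
    ... | yes same = forward (m≤n⇒m<n∨m≡n (≤-pred i<1+j))
      where
      W1+i≡Wj : walk (suc i) ≡ walk j
      W1+i≡Wj = trans (cong (step i) Wi≡W1+j) (trans (step-cong i j same _) (step-inv j (walk j)))
      forward : i < j ⊎ i ≡ j → ∃ λ t → t < suc j × Stop t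
      forward (inj₂ refl) = i , ≤-refl , W1+i≡Wj
      forward (inj₁ i<j) with repeat⇒stop j (suc i) (≤∧≢⇒< i<j λ { refl → not-¬ refl same }) W1+i≡Wj
      ... | t , t<j , st = t , m≤n⇒m≤1+n t<j , st
    repeat⇒stop (suc zero) zero _ _ | no differ = ⊥-elim (differ refl)
    repeat⇒stop (suc (suc j)) zero _ s≡W2+j | no differ
      with repeat⇒stop (suc j) zero z<s (sym W1+j≡s)
      where
      odd : isEven (suc j) ≡ false
      odd = ¬-not (differ ∘ sym)
      W1+j≡s : walk (suc j) ≡ s
      W1+j≡s = begin
        walk (suc j)                          ≡⟨ sym (step-inv (suc j) _) ⟩
        step (suc j) (walk (suc (suc j)))     ≡⟨ cong (step (suc j)) (sym s≡W2+j) ⟩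
        step (suc j) s                        ≡⟨ cong (λ b → (if b then σ else τ) s) odd ⟩
        τ s                                   ≡⟨ τs≡s ⟩
        s                                     ∎
        where open ≡-Reasoning
    ... | t , t<1+j , st = t , m≤n⇒m≤1+n t<1+j , st
    repeat⇒stop (suc j) (suc i) 1+i<1+j W1+i≡W1+j | no differ
      with repeat⇒stop j i (≤-pred 1+i<1+j) Wi≡Wj
      where
      same : isEven i ≡ isEven j
      same = not-injective (¬-not differ)
      Wi≡Wj : walk i ≡ walk j
      Wi≡Wj = begin
        walk i                     ≡⟨ sym (step-inv i _) ⟩
        step i (walk (suc i))      ≡⟨ cong (step i) W1+i≡W1+j ⟩
        step i (step j (walk j))   ≡⟨ step-cong i j same _ ⟩
        step j (step j (walk j))   ≡⟨ step-inv j _ ⟩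
        walk j                     ∎
        where open ≡-Reasoning
    ... | t , t<j , st = t , m≤n⇒m≤1+n t<j , st

    stop-exists : ∃ λ t → t < n × Stop t
    stop-exists with pigeonhole (n<1+n n) (λ i → walk (toℕ i))
    ... | i , j , i<j , Wi≡Wj with repeat⇒stop (toℕ j) (toℕ i) i<j Wi≡Wj
    ...   | t , t<j , st = t , <-≤-trans t<j (toℕ≤pred[n] j) , st

    private
      stopTime-spec : stopsAt stopTime ≡ true × (∀ u → u < stopTime → stopsAt u ≡ false)
      stopTime-spec =
        let t , t<n , st = stop-exists in
        firstFrom-least stopsAt n 0 t (λ _ ()) (≡⇒== st) t<n

    stopTime-stops : Stop stopTime
    stopTime-stops = ==⇒≡ (proj₁ stopTime-spec)

    stopTime-least : ∀ u → u < stopTime → ¬ Stop u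
    stopTime-least u u<k = ==⇒≢ (proj₂ stopTime-spec u u<k)

    stopTime<n : stopTime < n
    stopTime<n with stopTime <? n
    ... | yes k<n = k<n
    ... | no  k≮n = let t , t<n , st = stop-exists in
      ⊥-elim (stopTime-least t (<-≤-trans t<n (≮⇒≥ k≮n)) st)

    walk-injective : ∀ i j → i < j → j ≤ stopTime → walk i ≢ walk j
    walk-injective i j i<j j≤k Wi≡Wj =
      let t , t<j , st = repeat⇒stop j i i<j Wi≡Wj in stopTime-least t (<-≤-trans t<j j≤k) st

    start-onWalk : onWalk s ≡ true
    start-onWalk = visits-intro walk stopTime 0 z≤n

    end-onWalk : onWalk end ≡ true
    end-onWalk = visits-intro walk stopTime stopTime ≤-refl

    onWalk-closed : ∀ b v → onWalk v ≡ true → onWalk ((if b then σ else τ) v) ≡ true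
    onWalk-closed b v v∈ with visits-elim walk stopTime v v∈
    ... | i , i≤k , refl with b ≟ᵇ isEven i
    ...   | yes refl with m≤n⇒m<n∨m≡n i≤k
    ...     | inj₁ i<k  = visits-intro walk stopTime (suc i) i<k
    ...     | inj₂ refl = subst (λ w → onWalk w ≡ true) (sym stopTime-stops) end-onWalk
    onWalk-closed b v v∈ | zero , _ , refl | no b≢true rewrite ¬-not b≢true =
      subst (λ w → onWalk w ≡ true) (sym τs≡s) start-onWalk
    onWalk-closed b v v∈ | suc i , i≤k , refl | no b≢parity =
      subst (λ w → onWalk w ≡ true) back (visits-intro walk stopTime i (<⇒≤ i≤k))
      where
      b≡ : b ≡ isEven i
      b≡ = trans (¬-not b≢parity) (not-involutive _)
      back : walk i ≡ (if b then σ else τ) (walk (suc i))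
      back = trans (sym (step-inv i (walk i))) (cong (λ c → (if c then σ else τ) (walk (suc i))) (sym b≡))

    onWalk-moved : ∀ v → onWalk v ≡ true → v ≢ s → v ≢ end →
      ∀ b → (if b then σ else τ) v ≢ v
    onWalk-moved v v∈ v≢s v≢e b with visits-elim walk stopTime v v∈
    ... | zero  , _ , refl = ⊥-elim (v≢s refl)
    ... | suc i , i<k , refl with m≤n⇒m<n∨m≡n i<k
    ...   | inj₂ 1+i≡k = ⊥-elim (v≢e (cong walk 1+i≡k))
    ...   | inj₁ 1+i<k with b ≟ᵇ isEven (suc i)
    ...     | yes refl = λ e → walk-injective (suc i) (suc (suc i)) ≤-refl 1+i<k (sym e)
    ...     | no b≢ = λ e → walk-injective i (suc i) ≤-refl (<⇒≤ 1+i<k) (trans (sym back) e)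
      where
      b≡ : b ≡ isEven i
      b≡ = trans (¬-not b≢) (not-involutive _)
      back : (if b then σ else τ) (walk (suc i)) ≡ walk i
      back = subst (λ c → (if c then σ else τ) (walk (suc i)) ≡ walk i) (sym b≡) (step-inv i (walk i))

    end≢start : σ s ≢ s → end ≢ s
    end≢start σs≢s e≡s = walk-injective 0 stopTime 0<k ≤-refl (sym e≡s)
      where
      0<k : 0 < stopTime
      0<k = n≢0⇒n>0 (λ k≡0 → σs≢s (subst Stop k≡0 stopTime-stops))

    path-isPath : IsPath σ τ s end path
    path-isPath =
      segment-head walk 0 stopTime ,
      segment-last walk 0 stopTime ,
      segment-unique walk 0 stopTime (λ p q _ p<q q≤k → walk-injective p q p<q q≤k) ,
      segment-linked walk (Moves σ τ) 0 stopTime edge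
      where
      edge : ∀ j → 0 ≤ j → j < stopTime → Moves σ τ (walk j) (walk (suc j))
      edge j _ j<k with isEven j | walk-injective j (suc j) ≤-refl j<k
      ... | true  | d = inj₁ (refl , d)
      ... | false | d = inj₂ (refl , d)

    -- The walk traced backwards from its end is again such a walk, with the roles of σ and τ
    -- chosen by the parity of its length.
    private
      σʳ τʳ : Fin n → Fin n
      σʳ = if isEven stopTime then τ else σ
      τʳ = if isEven stopTime then σ else τ

      τʳ-end : τʳ end ≡ end
      τʳ-end = stopTime-stops

      σʳ-end : σ s ≢ s → σʳ end ≢ end
      σʳ-end σs≢s = at stopTime refl
        where
        at : ∀ k → k ≡ stopTime → (if isEven k then τ else σ) (walk k) ≢ walk k
        at zero    k≡ _ = σs≢s (subst Stop (sym k≡) stopTime-stops)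
        at (suc j) k≡ e = walk-injective j (suc j) ≤-refl (≤-reflexive k≡) (trans (sym back) e)
          where
          previous : (if isEven (suc j) then τ else σ) ≡ step j
          previous with isEven j
          ... | true  = refl
          ... | false = refl
          back : (if isEven (suc j) then τ else σ) (walk (suc j)) ≡ walk j
          back = trans (cong (λ f → f (walk (suc j))) previous) (step-inv j (walk j))

      module R = Walk σʳ τʳ end

      reversed-step : ∀ i → i < stopTime → ∀ v → R.step i v ≡ step (stopTime ∸ suc i) v
      reversed-step i i<k v = cong (λ f → f v)
        (lemma (isEven stopTime) (isEven i) (isEven (stopTime ∸ suc i)) parity)
        where
        parity : isEven stopTime ≡ (if isEven (stopTime ∸ suc i) then not (isEven i) else not (not (isEven i)))
        parity = trans (cong isEven (sym (m∸n+n≡m i<k))) (isEven-+ (stopTime ∸ suc i) (suc i))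
        lemma : ∀ pk pi pj → pk ≡ (if pj then not pi else not (not pi)) →
          (if pi then (if pk then τ else σ) else (if pk then σ else τ)) ≡ (if pj then σ else τ)
        lemma true  true  false _ = refl
        lemma true  false true  _ = refl
        lemma false true  true  _ = refl
        lemma false false false _ = refl
        lemma true  true  true  ()
        lemma true  false false ()
        lemma false true  false ()
        lemma false false true  ()

      reversed-walk : ∀ i → i ≤ stopTime → R.walk i ≡ walk (stopTime ∸ i)
      reversed-walk zero    _    = refl
      reversed-walk (suc i) i<k = begin
        R.step i (R.walk i)          ≡⟨ cong (R.step i) (reversed-walk i (<⇒≤ i<k)) ⟩
        R.step i (walk (k ∸ i))      ≡⟨ reversed-step i i<k _ ⟩
        step j (walk (k ∸ i))        ≡⟨ cong (λ x → step j (walk x)) (+-∸-assoc 1 i<k) ⟩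
        step j (step j (walk j))     ≡⟨ step-inv j _ ⟩
        walk j                       ∎
        where
        open ≡-Reasoning
        k j : ℕ
        k = stopTime
        j = stopTime ∸ suc i

      reaches-start : R.walk stopTime ≡ s
      reaches-start = trans (reversed-walk stopTime ≤-refl) (cong walk (n∸n≡0 stopTime))

      stops-at-start : R.stopsAt stopTime ≡ true
      stops-at-start = ≡⇒== (begin
        R.step stopTime (R.walk stopTime) ≡⟨ cong (λ f → f (R.walk stopTime)) τ-at-k ⟩
        τ (R.walk stopTime)               ≡⟨ cong τ reaches-start ⟩
        τ s                               ≡⟨ τs≡s ⟩
        s                                 ≡⟨ sym reaches-start ⟩
        R.walk stopTime                   ∎)
        where
        open ≡-Reasoning
        τ-at-k : (if isEven stopTime then σʳ else τʳ) ≡ τ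
        τ-at-k with isEven stopTime
        ... | true  = refl
        ... | false = refl

      no-earlier-stop : ∀ u → u < stopTime → R.stopsAt u ≡ false
      no-earlier-stop u u<k = ≢⇒== λ e →
        walk-injective (stopTime ∸ suc u) (stopTime ∸ u) (≤-reflexive (sym (+-∸-assoc 1 u<k))) (m∸n≤m stopTime u)
          (trans (sym (reversed-walk (suc u) u<k)) (trans e (reversed-walk u (<⇒≤ u<k))))

      reversed-stopTime : R.stopTime ≡ stopTime
      reversed-stopTime =
        let first , below = firstFrom-least R.stopsAt n 0 stopTime (λ _ ()) stops-at-start stopTime<n in
        least-unique R.stopsAt R.stopTime stopTime first below stops-at-start no-earlier-stop

      reversal : Walk.end σʳ τʳ end ≡ s
      reversal = trans (cong R.walk reversed-stopTime) reaches-start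

      end-cases : σ s ≢ s →
        (σ end ≡ end × τ end ≢ end × isEven stopTime ≡ true  × Walk.end τ σ end ≡ s) ⊎
        (τ end ≡ end × σ end ≢ end × isEven stopTime ≡ false × Walk.end σ τ end ≡ s)
      end-cases σs≢s with isEven stopTime | τʳ-end | σʳ-end σs≢s | reversal
      ... | true  | fixed | moved | back = inj₁ (fixed , moved , refl , back)
      ... | false | fixed | moved | back = inj₂ (fixed , moved , refl , back)

    end-facts : σ s ≢ s → PartnerFacts σ τ s end
    end-facts σs≢s = record
      { degreeOne = degreeOne ; moves = end≢start σs≢s ; involutive = involutive
      ; length = stopTime ; vertices = path ; isPath = path-isPath ; even = even }
      where
      degreeOne : DegreeOne σ τ end
      degreeOne with end-cases σs≢s
      ... | inj₁ (σe , τe , _) = inj₂ (σe , τe)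
      ... | inj₂ (τe , σe , _) = inj₁ (τe , σe)
      involutive : partner σ τ end ≡ s
      involutive with end-cases σs≢s
      ... | inj₁ (_ , τe≢e , _ , back) = trans (partner-σ τe≢e) back
      ... | inj₂ (τe≡e , _ , _ , back) = trans (partner-τ τe≡e) back
      even : FixedByDifferent σ τ s end → isEven stopTime ≡ true
      even (inj₂ (σs≡s , _)) = ⊥-elim (σs≢s σs≡s)
      even (inj₁ (_ , σe≡e)) with end-cases σs≢s
      ... | inj₁ (_ , _ , k-even , _) = k-even
      ... | inj₂ (_ , σe≢e , _)       = ⊥-elim (σe≢e σe≡e)

  module WalkCongruence {n : ℕ} (σ τ : Fin n → Fin n)
    (σ-inv : ∀ v → σ (σ v) ≡ v) (τ-inv : ∀ v → τ (τ v) ≡ v) {s : Fin n} (τs≡s : τ s ≡ s)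
    (σ′ τ′ : Fin n → Fin n)
    (agree : ∀ v → Walk.onWalk σ τ s v ≡ true → σ′ v ≡ σ v × τ′ v ≡ τ v) where

    open Walk σ τ s
    open WalkProperties σ τ σ-inv τ-inv τs≡s
    private
      module W′ = Walk σ′ τ′ s

      walk-agrees : ∀ i → i ≤ suc stopTime → W′.walk i ≡ walk i
      walk-agrees zero    _ = refl
      walk-agrees (suc i) i≤ = trans (cong (W′.step i) (walk-agrees i (<⇒≤ i≤)))
                                     (step-agrees (isEven i) (visits-intro walk stopTime i (≤-pred i≤)))
        where
        step-agrees : ∀ b → onWalk (walk i) ≡ true →
          (if b then σ′ else τ′) (walk i) ≡ (if b then σ else τ) (walk i)
        step-agrees true  w∈ = proj₁ (agree (walk i) w∈)
        step-agrees false w∈ = proj₂ (agree (walk i) w∈)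

      stopsAt-agrees : ∀ u → u ≤ stopTime → W′.stopsAt u ≡ stopsAt u
      stopsAt-agrees u u≤k = cong₂ _==_ (walk-agrees (suc u) (s≤s u≤k)) (walk-agrees u (m≤n⇒m≤1+n u≤k))

      first : stopsAt stopTime ≡ true
      first = ≡⇒== stopTime-stops

      stopTime-agrees : W′.stopTime ≡ stopTime
      stopTime-agrees =
        let first′ , below′ = firstFrom-least W′.stopsAt n 0 stopTime (λ _ ()) stops stopTime<n
        in least-unique W′.stopsAt W′.stopTime stopTime first′ below′ stops earlier
        where
        stops : W′.stopsAt stopTime ≡ true
        stops = trans (stopsAt-agrees stopTime ≤-refl) first
        earlier : ∀ u → u < stopTime → W′.stopsAt u ≡ false
        earlier u u<k = trans (stopsAt-agrees u (<⇒≤ u<k)) (≢⇒== (stopTime-least u u<k))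

    onWalk-agrees : ∀ v → W′.onWalk v ≡ onWalk v
    onWalk-agrees v rewrite stopTime-agrees =
      visits-cong W′.walk walk v stopTime (λ i i≤k → walk-agrees i (m≤n⇒m≤1+n i≤k))

    end-agrees : W′.end ≡ end
    end-agrees rewrite stopTime-agrees = walk-agrees stopTime (n≤1+n stopTime)

  module ThroughProperties {n : ℕ} (σ τ : Fin n → Fin n)
    (σ-inv : ∀ v → σ (σ v) ≡ v) (τ-inv : ∀ v → τ (τ v) ≡ v) {v : Fin n} (deg : DegreeOne σ τ v) where

    open Through σ τ v

    σ₀-inv : ∀ w → σ₀ (σ₀ w) ≡ w
    σ₀-inv w with τ v == v
    ... | true  = σ-inv w
    ... | false = τ-inv w

    τ₀-inv : ∀ w → τ₀ (τ₀ w) ≡ w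
    τ₀-inv w with τ v == v
    ... | true  = τ-inv w
    ... | false = σ-inv w

    τ₀v≡v : τ₀ v ≡ v
    τ₀v≡v = fixes deg
      where
      fixes : DegreeOne σ τ v → τ₀ v ≡ v
      fixes (inj₁ (τv≡v , _))      rewrite ≡⇒== τv≡v = τv≡v
      fixes (inj₂ (σv≡v , τv≢v)) rewrite ≢⇒== τv≢v = σv≡v

    open WalkProperties σ₀ τ₀ σ₀-inv τ₀-inv τ₀v≡v public

    component-closed : ∀ w → onWalk w ≡ true → onWalk (σ w) ≡ true × onWalk (τ w) ≡ true
    component-closed w w∈ = subst (λ u → onWalk u ≡ true) (σ-step w) (onWalk-closed (τ v == v) w w∈)
                          , subst (λ u → onWalk u ≡ true) (τ-step w) (onWalk-closed (not (τ v == v)) w w∈)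
      where
      σ-step : ∀ w → (if τ v == v then σ₀ else τ₀) w ≡ σ w
      σ-step w with τ v == v
      ... | true  = refl
      ... | false = refl
      τ-step : ∀ w → (if not (τ v == v) then σ₀ else τ₀) w ≡ τ w
      τ-step w with τ v == v
      ... | true  = refl
      ... | false = refl

    component-fixed : ∀ w → onWalk w ≡ true → σ w ≡ w ⊎ τ w ≡ w → w ≡ v ⊎ w ≡ end
    component-fixed w w∈ fixed with w ≟ᶠ v | w ≟ᶠ end
    ... | yes w≡v | _       = inj₁ w≡v
    ... | no _    | yes w≡e = inj₂ w≡e
    ... | no w≢v  | no w≢e  = ⊥-elim (moved fixed)
      where
      moved : σ w ≡ w ⊎ τ w ≡ w → ⊥
      moved (inj₁ σw≡w) with τ v == v | onWalk-moved w w∈ w≢v w≢e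
      ... | true  | m = m true σw≡w
      ... | false | m = m false σw≡w
      moved (inj₂ τw≡w) with τ v == v | onWalk-moved w w∈ w≢v w≢e
      ... | true  | m = m false τw≡w
      ... | false | m = m true τw≡w

    module Exchange (σ′ τ′ : Fin n → Fin n)
      (exchanged : ∀ w → onWalk w ≡ true → σ′ w ≡ τ w × τ′ w ≡ σ w) where

      private
        module T′ = Through σ′ τ′ v

        agree : ∀ w → onWalk w ≡ true → T′.σ₀ w ≡ σ₀ w × T′.τ₀ w ≡ τ₀ w
        agree w w∈ = by deg (proj₂ (exchanged v start-onWalk)) (exchanged w w∈)
          where
          by : DegreeOne σ τ v → τ′ v ≡ σ v → σ′ w ≡ τ w × τ′ w ≡ σ w →
               T′.σ₀ w ≡ σ₀ w × T′.τ₀ w ≡ τ₀ w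
          by (inj₁ (τv≡v , σv≢v)) τ′v≡σv (σ′w≡τw , τ′w≡σw)
            rewrite ≡⇒== τv≡v | ≢⇒== (subst (_≢ v) (sym τ′v≡σv) σv≢v) = τ′w≡σw , σ′w≡τw
          by (inj₂ (σv≡v , τv≢v)) τ′v≡σv (σ′w≡τw , τ′w≡σw)
            rewrite ≢⇒== τv≢v | ≡⇒== (trans τ′v≡σv σv≡v) = σ′w≡τw , τ′w≡σw

        open WalkCongruence σ₀ τ₀ σ₀-inv τ₀-inv τ₀v≡v T′.σ₀ T′.τ₀ agree

      onWalk-exchange : ∀ w → T′.onWalk w ≡ onWalk w
      onWalk-exchange = onWalk-agrees

      end-exchange : T′.end ≡ end
      end-exchange = end-agrees

  partner-facts : ∀ {n} (σ τ : Fin n → Fin n) → (∀ v → σ (σ v) ≡ v) → (∀ v → τ (τ v) ≡ v) →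
    ∀ {v} → DegreeOne σ τ v → PartnerFacts σ τ v (partner σ τ v)
  partner-facts σ τ σ-inv τ-inv {v} (inj₁ (τv≡v , σv≢v)) =
    subst (PartnerFacts σ τ v) (sym (partner-τ τv≡v)) (WalkProperties.end-facts σ τ σ-inv τ-inv τv≡v σv≢v)
  partner-facts σ τ σ-inv τ-inv {v} (inj₂ (σv≡v , τv≢v)) =
    subst (PartnerFacts σ τ v) (sym (partner-σ τv≢v))
      (PartnerFacts-swap (WalkProperties.end-facts τ σ τ-inv σ-inv σv≡v τv≢v))

open AlternatingWalks

module FiniteSums where

  open import Data.Fin.Properties using (0≢1+n; suc-injective)
  open import Data.List using ([]; _∷_; foldr; concatMap; _++_)

  DecEq : Set → Set
  DecEq A = (x y : A) → Dec (x ≡ y)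

  module ListFold {c ℓ : Level} (M : CommutativeMonoid c ℓ) where

    open CommutativeMonoid M renaming (refl to ≈-refl; sym to ≈-sym; trans to ≈-trans; reflexive to ≈-reflexive)
    open import Algebra.Properties.CommutativeSemigroup commutativeSemigroup using (interchange)
    open import Relation.Binary.Reasoning.Setoid (CommutativeMonoid.setoid M)

    fold : {A : Set} → List A → (A → Carrier) → Carrier
    fold []       f = ε
    fold (x ∷ xs) f = f x ∙ fold xs f

    foldr-map : {A : Set} (xs : List A) (f : A → Carrier) → foldr _∙_ ε (map f xs) ≡ fold xs f
    foldr-map []       f = ≡.refl
    foldr-map (x ∷ xs) f = ≡.cong (f x ∙_) (foldr-map xs f)

    fold-cong : {A : Set} (xs : List A) {f g : A → Carrier} → (∀ x → f x ≈ g x) → fold xs f ≈ fold xs g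
    fold-cong []       f≈g = ≈-refl
    fold-cong (x ∷ xs) f≈g = ∙-cong (f≈g x) (fold-cong xs f≈g)

    fold-ε : {A : Set} (xs : List A) {f : A → Carrier} → (∀ x → f x ≈ ε) → fold xs f ≈ ε
    fold-ε []       f≈ε = ≈-refl
    fold-ε (x ∷ xs) f≈ε = ≈-trans (∙-cong (f≈ε x) (fold-ε xs f≈ε)) (identityˡ ε)

    fold-∙ : {A : Set} (xs : List A) (f g : A → Carrier) →
      fold xs (λ x → f x ∙ g x) ≈ fold xs f ∙ fold xs g
    fold-∙ []       f g = ≈-sym (identityˡ ε)
    fold-∙ (x ∷ xs) f g = begin
      (f x ∙ g x) ∙ fold xs (λ x → f x ∙ g x) ≈⟨ ∙-congˡ (fold-∙ xs f g) ⟩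
      (f x ∙ g x) ∙ (fold xs f ∙ fold xs g)   ≈⟨ interchange _ _ _ _ ⟩
      (f x ∙ fold xs f) ∙ (g x ∙ fold xs g)   ∎

    fold-++ : {A : Set} (xs ys : List A) (f : A → Carrier) → fold (xs ++ ys) f ≈ fold xs f ∙ fold ys f
    fold-++ []       ys f = ≈-sym (identityˡ _)
    fold-++ (x ∷ xs) ys f = ≈-trans (∙-congˡ (fold-++ xs ys f)) (≈-sym (assoc _ _ _))

    fold-map : {A B : Set} (xs : List A) (g : A → B) (f : B → Carrier) → fold (map g xs) f ≡ fold xs (f ∘ g)
    fold-map []       g f = ≡.refl
    fold-map (x ∷ xs) g f = ≡.cong (f (g x) ∙_) (fold-map xs g f)

    fold-concatMap : {A B : Set} (xs : List A) (g : A → List B) (f : B → Carrier) →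
      fold (concatMap g xs) f ≈ fold xs (λ x → fold (g x) f)
    fold-concatMap []       g f = ≈-refl
    fold-concatMap (x ∷ xs) g f = ≈-trans (fold-++ (g x) (concatMap g xs) f) (∙-congˡ (fold-concatMap xs g f))

    fold-comm : {A B : Set} (xs : List A) (ys : List B) (F : A → B → Carrier) →
      fold xs (λ x → fold ys (F x)) ≈ fold ys (λ y → fold xs (λ x → F x y))
    fold-comm []       ys F = ≈-sym (fold-ε ys (λ _ → ≈-refl))
    fold-comm (x ∷ xs) ys F = ≈-trans (∙-congˡ (fold-comm xs ys F)) (≈-sym (fold-∙ ys (F x) _))

    fold-concatMap-map : {A B C : Set} (xs : List A) (ys : List B) (g : A → B → C) (f : C → Carrier) →
      fold (concatMap (λ x → map (g x) ys) xs) f ≈ fold xs (λ x → fold ys (λ y → f (g x y)))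
    fold-concatMap-map xs ys g f =
      ≈-trans (fold-concatMap xs _ f) (fold-cong xs (λ x → ≈-reflexive (fold-map ys (g x) f)))

    when : {Q : Set} → Dec Q → Carrier → Carrier
    when (yes _) a = a
    when (no _)  _ = ε

    when-iff : {Q Q′ : Set} → (Q → Q′) → (Q′ → Q) → (d : Dec Q) (d′ : Dec Q′) (a : Carrier) → when d a ≡ when d′ a
    when-iff to from (yes q) (yes _)  a = ≡.refl
    when-iff to from (yes q) (no ¬q′) a with () ← ¬q′ (to q)
    when-iff to from (no ¬q) (yes q′) a with () ← ¬q (from q′)
    when-iff to from (no _)  (no _)   a = ≡.refl

    when-yes : {Q : Set} (d : Dec Q) → Q → ∀ a → when d a ≡ a
    when-yes (yes _) q a = ≡.refl
    when-yes (no ¬q) q a with () ← ¬q q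

    when-no : {Q : Set} (d : Dec Q) → ¬ Q → ∀ a → when d a ≡ ε
    when-no (yes q) ¬q a with () ← ¬q q
    when-no (no _)  ¬q a = ≡.refl

    when-× : {Q Q′ Q″ : Set} → (Q → Q′ × Q″) → (Q′ → Q″ → Q) →
      (d : Dec Q) (d′ : Dec Q′) (d″ : Dec Q″) (a : Carrier) → when d a ≡ when d′ (when d″ a)
    when-× to from (yes q)  (yes _)   (yes _)   a = ≡.refl
    when-× to from (yes q)  (yes _)   (no ¬q″)  a with () ← ¬q″ (proj₂ (to q))
    when-× to from (yes q)  (no ¬q′)  _         a with () ← ¬q′ (proj₁ (to q))
    when-× to from (no ¬q)  (yes q′)  (yes q″)  a with () ← ¬q (from q′ q″)
    when-× to from (no _)   (yes _)   (no _)    a = ≡.refl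
    when-× to from (no _)   (no _)    _         a = ≡.refl

    when-cong : {Q : Set} (d : Dec Q) {a b : Carrier} → a ≈ b → when d a ≈ when d b
    when-cong (yes _) a≈b = a≈b
    when-cong (no _)  _   = ≈-refl

    fold-when : {A Q : Set} (xs : List A) (d : Dec Q) (f : A → Carrier) →
      fold xs (λ x → when d (f x)) ≈ when d (fold xs f)
    fold-when xs (yes _) f = ≈-refl
    fold-when xs (no _)  f = fold-ε xs (λ _ → ≈-refl)

    -- xs lists every element of X exactly once, expressed by counting.
    Enumerates : {X : Set} → DecEq X → List X → Set (c Level.⊔ ℓ)
    Enumerates _≟_ xs = ∀ z a → fold xs (λ x → when (x ≟ z) a) ≈ a

    fold-tabulate-ε : ∀ k {B : Set} (g : Fin k → B) {f : B → Carrier} →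
      (∀ i → f (g i) ≈ ε) → fold (toList (tabulate g)) f ≈ ε
    fold-tabulate-ε zero    g f≈ε = ≈-refl
    fold-tabulate-ε (suc k) g f≈ε =
      ≈-trans (∙-cong (f≈ε zero) (fold-tabulate-ε k (g ∘ suc) (f≈ε ∘ suc))) (identityˡ ε)

    tabulate-enumerates : ∀ k {B : Set} (_≟_ : DecEq B) (f : Fin k → B) →
      (∀ {i j} → f i ≡ f j → i ≡ j) →
      ∀ z a → fold (toList (tabulate f)) (λ b → when (b ≟ f z) a) ≈ a
    tabulate-enumerates (suc k) _≟_ f f-inj zero a =
      ≈-trans (∙-cong (≈-reflexive (when-yes (f zero ≟ f zero) ≡.refl a)) (fold-tabulate-ε k (f ∘ suc) others))
              (identityʳ a)
      where
      others : ∀ i → when (f (suc i) ≟ f zero) a ≈ ε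
      others i = ≈-reflexive (when-no (f (suc i) ≟ f zero) (λ e → 0≢1+n (≡.sym (f-inj e))) a)
    tabulate-enumerates (suc k) _≟_ f f-inj (suc z) a =
      ≈-trans (∙-congʳ (≈-reflexive (when-no (f zero ≟ f (suc z)) (λ e → 0≢1+n (f-inj e)) a)))
            (≈-trans (identityˡ _) (tabulate-enumerates k _≟_ (f ∘ suc) (suc-injective ∘ f-inj) z a))

    concatMap-enumerates : {A B C : Set} (_≟A_ : DecEq A) (_≟B_ : DecEq B) (_≟C_ : DecEq C)
      (xs : List A) (ys : List B) → Enumerates _≟A_ xs → Enumerates _≟B_ ys →
      (g : A → B → C) → (∀ {x y x′ y′} → g x y ≡ g x′ y′ → x ≡ x′ × y ≡ y′) →
      ∀ x₀ y₀ a → fold (concatMap (λ x → map (g x) ys) xs) (λ c → when (c ≟C g x₀ y₀) a) ≈ a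
    concatMap-enumerates _≟A_ _≟B_ _≟C_ xs ys enumA enumB g g-inj x₀ y₀ a = begin
      fold (concatMap (λ x → map (g x) ys) xs) (λ c → when (c ≟C g x₀ y₀) a)
        ≈⟨ fold-concatMap-map xs ys g _ ⟩
      fold xs (λ x → fold ys (λ y → when (g x y ≟C g x₀ y₀) a))
        ≈⟨ fold-cong xs (λ x → fold-cong ys (λ y → ≈-reflexive (split x y))) ⟩
      fold xs (λ x → fold ys (λ y → when (x ≟A x₀) (when (y ≟B y₀) a)))
        ≈⟨ fold-cong xs (λ x → fold-when ys (x ≟A x₀) _) ⟩
      fold xs (λ x → when (x ≟A x₀) (fold ys (λ y → when (y ≟B y₀) a)))
        ≈⟨ fold-cong xs (λ x → when-cong (x ≟A x₀) (enumB y₀ a)) ⟩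
      fold xs (λ x → when (x ≟A x₀) a)
        ≈⟨ enumA x₀ a ⟩
      a ∎
      where
      split : ∀ x y → when (g x y ≟C g x₀ y₀) a ≡ when (x ≟A x₀) (when (y ≟B y₀) a)
      split x y = when-× g-inj (≡.cong₂ g) (g x y ≟C g x₀ y₀) (x ≟A x₀) (y ≟B y₀) a

    allVecs-enumerates : ∀ k m → Enumerates (≡-decⱽ (_≟ᶠ_ {k})) (allVecs k m)
    allVecs-enumerates k zero    [] a = identityʳ a
    allVecs-enumerates k (suc m) (z ∷ zs) a =
      concatMap-enumerates _≟ᶠ_ (≡-decⱽ _≟ᶠ_) (≡-decⱽ _≟ᶠ_) (toList (allFin k)) (allVecs k m)
        (tabulate-enumerates k _≟ᶠ_ (λ i → i) (λ e → e)) (allVecs-enumerates k m)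
        _∷_ ∷-injective z zs a

    fold-involution : {X : Set} (_≟_ : DecEq X) (xs : List X) → Enumerates _≟_ xs →
      (φ : X → X) → (∀ x → φ (φ x) ≡ x) → (f : X → Carrier) → fold xs (f ∘ φ) ≈ fold xs f
    fold-involution _≟_ xs enum φ φ-inv f = begin
      fold xs (λ p → f (φ p))                                     ≈⟨ fold-cong xs (λ p → ≈-sym (enum (φ p) (f (φ p)))) ⟩
      fold xs (λ p → fold xs (λ q → when (q ≟ φ p) (f (φ p))))    ≈⟨ fold-cong xs (λ p → fold-cong xs (λ q → at q p)) ⟩
      fold xs (λ p → fold xs (λ q → when (q ≟ φ p) (f q)))        ≈⟨ fold-comm xs xs _ ⟩
      fold xs (λ q → fold xs (λ p → when (q ≟ φ p) (f q)))        ≈⟨ fold-cong xs (λ q → fold-cong xs (flip q)) ⟩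
      fold xs (λ q → fold xs (λ p → when (p ≟ φ q) (f q)))        ≈⟨ fold-cong xs (λ q → enum (φ q) (f q)) ⟩
      fold xs f                                                   ∎
      where
      at : ∀ q p → when (q ≟ φ p) (f (φ p)) ≈ when (q ≟ φ p) (f q)
      at q p with q ≟ φ p
      ... | yes q≡φp = ≈-reflexive (≡.cong f (≡.sym q≡φp))
      ... | no _     = ≈-refl
      flip : ∀ q p → when (q ≟ φ p) (f q) ≈ when (p ≟ φ q) (f q)
      flip q p = ≈-reflexive (when-iff (λ e → ≡.trans (≡.sym (φ-inv p)) (≡.cong φ (≡.sym e)))
                                       (λ e → ≡.trans (≡.sym (φ-inv q)) (≡.cong φ (≡.sym e)))
                                       (q ≟ φ p) (p ≟ φ q) (f q))

  module RingSums {c ℓ : Level} (R : CommutativeRing c ℓ) where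

    open CommutativeRing R renaming (refl to ≈-refl; sym to ≈-sym; trans to ≈-trans; reflexive to ≈-reflexive)
    open import Relation.Binary.Reasoning.Setoid (CommutativeRing.setoid R)
    module Σ = ListFold +-commutativeMonoid
    module Π = ListFold *-commutativeMonoid
    open Σ using (fold)

    fold-*ˡ : {A : Set} (xs : List A) (a : Carrier) (f : A → Carrier) → a * fold xs f ≈ fold xs (λ x → a * f x)
    fold-*ˡ []       a f = zeroʳ a
    fold-*ˡ (x ∷ xs) a f = ≈-trans (distribˡ a _ _) (+-congˡ (fold-*ˡ xs a f))

    fold-*ʳ : {A : Set} (xs : List A) (a : Carrier) (f : A → Carrier) → fold xs f * a ≈ fold xs (λ x → f x * a)
    fold-*ʳ []       a f = zeroˡ a
    fold-*ʳ (x ∷ xs) a f = ≈-trans (distribʳ a _ _) (+-congˡ (fold-*ʳ xs a f))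

    allPairs : {A B : Set} → List A → List B → List (A × B)
    allPairs xs ys = concatMap (λ x → map (x ,_) ys) xs

    fold-allPairs : {A B : Set} (xs : List A) (ys : List B) (f : A → Carrier) (g : B → Carrier) →
      fold xs f * fold ys g ≈ fold (allPairs xs ys) (λ p → f (proj₁ p) * g (proj₂ p))
    fold-allPairs xs ys f g = begin
      fold xs f * fold ys g                         ≈⟨ fold-*ʳ xs _ f ⟩
      fold xs (λ x → f x * fold ys g)               ≈⟨ Σ.fold-cong xs (λ x → fold-*ˡ ys (f x) g) ⟩
      fold xs (λ x → fold ys (λ y → f x * g y))     ≈⟨ ≈-sym (Σ.fold-concatMap-map xs ys _,_ _) ⟩
      fold (allPairs xs ys) (λ p → f (proj₁ p) * g (proj₂ p)) ∎

open FiniteSums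

-- Perfect matchings

and-tabulate⁻ : ∀ {k} {B : Set} (f : B → Bool) (g : Fin k → B) →
  and (map f (toList (tabulate g))) ≡ true → ∀ i → f (g i) ≡ true
and-tabulate⁻ {suc k} f g e zero    with f (g zero)
... | true = refl
and-tabulate⁻ {suc k} f g e (suc i) with f (g zero)
... | true = and-tabulate⁻ f (g ∘ suc) e i

and-tabulate⁺ : ∀ {k} {B : Set} (f : B → Bool) (g : Fin k → B) →
  (∀ i → f (g i) ≡ true) → and (map f (toList (tabulate g))) ≡ true
and-tabulate⁺ {zero}  f g h = refl
and-tabulate⁺ {suc k} f g h rewrite h zero = and-tabulate⁺ f (g ∘ suc) (h ∘ suc)

module Matchings {r ℓ : Level} (R : CommutativeRing r ℓ) {n : ℕ} (G : WGraph R n) where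

  open CommutativeRing R using (Carrier; _*_; _≈_; *-comm; 1#)
    renaming (trans to ≈-trans; sym to ≈-sym; reflexive to ≈-reflexive)
  open RingSums R using (module Π)

  -- The test of isPM at v, as a function of the only values of D and m it reads.
  localCheck : Fin n → Bool → Fin n → Bool → Fin n → Bool
  localCheck v Dv mv Dmv mmv =
    if Dv then mv == v else (not Dmv ∧ not (mv == v) ∧ (mmv == v) ∧ adj G v mv)

  vertexCheck : (Fin n → Bool) → (Fin n → Fin n) → Fin n → Bool
  vertexCheck D m v = localCheck v (D v) (m v) (D (m v)) (m (m v))

  isPM⇒ : ∀ D m → isPM G D m ≡ true → ∀ v → vertexCheck (lookup D) (lookup m) v ≡ true
  isPM⇒ D m = and-tabulate⁻ (vertexCheck (lookup D) (lookup m)) (λ i → i)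

  ⇒isPM : ∀ D m → (∀ v → vertexCheck (lookup D) (lookup m) v ≡ true) → isPM G D m ≡ true
  ⇒isPM D m = and-tabulate⁺ (vertexCheck (lookup D) (lookup m)) (λ i → i)

  module PerfectMatching (D : Subset n) (m : Vec (Fin n) n) (pm : isPM G D m ≡ true) where

    deleted⇒fixed : ∀ v → lookup D v ≡ true → lookup m v ≡ v
    deleted⇒fixed v Dv with isPM⇒ D m pm v
    ... | c rewrite Dv = ==⇒≡ c

    kept⇒moved : ∀ v → lookup D v ≡ false → lookup m v ≢ v
    kept⇒moved v Dv with isPM⇒ D m pm v
    ... | c rewrite Dv with lookup D (lookup m v) | lookup m v == v in mv
    ...   | false | false = ==⇒≢ mv

    fixed⇒deleted : ∀ v → lookup m v ≡ v → lookup D v ≡ true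
    fixed⇒deleted v mv≡v with lookup D v in Dv
    ... | true  = refl
    ... | false = ⊥-elim (kept⇒moved v Dv mv≡v)

    involutive : ∀ v → lookup m (lookup m v) ≡ v
    involutive v with lookup D v in Dv | isPM⇒ D m pm v
    ... | true  | c = trans (cong (lookup m) (==⇒≡ c)) (==⇒≡ c)
    ... | false | c with lookup D (lookup m v) | lookup m v == v | lookup m (lookup m v) == v in mmv
    ...   | false | false | true = ==⇒≡ mmv

  swapOn : (Fin n → Bool) → Vec (Fin n) n → Vec (Fin n) n → Vec (Fin n) n
  swapOn P α β = tabulate (λ v → if P v then lookup β v else lookup α v)

  swapOn-in : ∀ P α β v → P v ≡ true → lookup (swapOn P α β) v ≡ lookup β v
  swapOn-in P α β v Pv rewrite lookup∘tabulate (λ v → if P v then lookup β v else lookup α v) v | Pv = refl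

  swapOn-out : ∀ P α β v → P v ≡ false → lookup (swapOn P α β) v ≡ lookup α v
  swapOn-out P α β v Pv rewrite lookup∘tabulate (λ v → if P v then lookup β v else lookup α v) v | Pv = refl

  swapOn-swapOn : ∀ (P P′ : Fin n → Bool) α β → (∀ v → P′ v ≡ P v) →
    swapOn P′ (swapOn P α β) (swapOn P β α) ≡ α
  swapOn-swapOn P P′ α β P′≡P = trans (tabulate-cong back) (tabulate∘lookup α)
    where
    back : ∀ v → (if P′ v then lookup (swapOn P β α) v else lookup (swapOn P α β) v) ≡ lookup α v
    back v rewrite P′≡P v with P v in Pv
    ... | true  = swapOn-in P β α v Pv
    ... | false = swapOn-out P α β v Pv

  swapOn-isPM : ∀ D₁ D₂ D₁′ α β → isPM G D₁ α ≡ true → isPM G D₂ β ≡ true →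
    (P : Fin n → Bool) →
    (∀ v → P v ≡ true → P (lookup α v) ≡ true) → (∀ v → P v ≡ true → P (lookup β v) ≡ true) →
    (∀ v → P v ≡ true → lookup D₁′ v ≡ lookup D₂ v) → (∀ v → P v ≡ false → lookup D₁′ v ≡ lookup D₁ v) →
    isPM G D₁′ (swapOn P α β) ≡ true
  swapOn-isPM D₁ D₂ D₁′ α β pα pβ P α-closed β-closed inside outside = ⇒isPM D₁′ γ check
    where
    γ : Vec (Fin n) n
    γ = swapOn P α β
    α-out : ∀ v → P v ≡ false → P (lookup α v) ≡ false
    α-out v Pv with P (lookup α v) in Pαv
    ... | false = refl
    ... | true  = trans (sym (trans (cong P (sym (PerfectMatching.involutive D₁ α pα v))) (α-closed _ Pαv))) Pv
    check : ∀ v → vertexCheck (lookup D₁′) (lookup γ) v ≡ true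
    check v with P v in Pv
    ... | true  =
      trans (cong₂ (λ d w → localCheck v d w (lookup D₁′ w) (lookup γ w)) (inside v Pv) (swapOn-in P α β v Pv))
        (trans (cong₂ (localCheck v (lookup D₂ v) (lookup β v))
                  (inside _ (β-closed v Pv)) (swapOn-in P α β _ (β-closed v Pv)))
           (isPM⇒ D₂ β pβ v))
    ... | false =
      trans (cong₂ (λ d w → localCheck v d w (lookup D₁′ w) (lookup γ w)) (outside v Pv) (swapOn-out P α β v Pv))
        (trans (cong₂ (localCheck v (lookup D₁ v) (lookup α v))
                  (outside _ (α-out v Pv)) (swapOn-out P α β _ (α-out v Pv)))
           (isPM⇒ D₁ α pα v))

  edgeFactor : (Fin n → Bool) → (Fin n → Fin n) → Fin n → Carrier
  edgeFactor D m v = if (not (D v) ∧ (toℕ v <ᵇ toℕ (m v))) then weight G v (m v) else 1#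

  edgeFactor-cong : ∀ D m D′ m′ v → D v ≡ D′ v → m v ≡ m′ v → edgeFactor D m v ≡ edgeFactor D′ m′ v
  edgeFactor-cong D m D′ m′ v = cong₂ (λ d w → if (not d ∧ (toℕ v <ᵇ toℕ w)) then weight G v w else 1#)

  -- At every vertex the two factors are either exchanged (on P) or unchanged (off P).
  swapOn-weight : ∀ D₁ D₂ D₁′ D₂′ α β (P : Fin n → Bool) →
    (∀ v → P v ≡ true → lookup D₁′ v ≡ lookup D₂ v) → (∀ v → P v ≡ false → lookup D₁′ v ≡ lookup D₁ v) →
    (∀ v → P v ≡ true → lookup D₂′ v ≡ lookup D₁ v) → (∀ v → P v ≡ false → lookup D₂′ v ≡ lookup D₂ v) →
    matchWeight R G D₁′ (swapOn P α β) * matchWeight R G D₂′ (swapOn P β α) ≈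
    matchWeight R G D₁ α * matchWeight R G D₂ β
  swapOn-weight D₁ D₂ D₁′ D₂′ α β P in₁ out₁ in₂ out₂ = begin
    matchWeight R G D₁′ α′ * matchWeight R G D₂′ β′
      ≡⟨ cong₂ _*_ (Π.foldr-map L (factor D₁′ α′)) (Π.foldr-map L (factor D₂′ β′)) ⟩
    Π.fold L (factor D₁′ α′) * Π.fold L (factor D₂′ β′)
      ≈⟨ ≈-sym (Π.fold-∙ L _ _) ⟩
    Π.fold L (λ v → factor D₁′ α′ v * factor D₂′ β′ v)
      ≈⟨ Π.fold-cong L pointwise ⟩
    Π.fold L (λ v → factor D₁ α v * factor D₂ β v)
      ≈⟨ Π.fold-∙ L _ _ ⟩
    Π.fold L (factor D₁ α) * Π.fold L (factor D₂ β)
      ≡⟨ sym (cong₂ _*_ (Π.foldr-map L (factor D₁ α)) (Π.foldr-map L (factor D₂ β))) ⟩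
    matchWeight R G D₁ α * matchWeight R G D₂ β ∎
    where
    open import Relation.Binary.Reasoning.Setoid (CommutativeRing.setoid R)
    L : List (Fin n)
    L = toList (allFin n)
    α′ β′ : Vec (Fin n) n
    α′ = swapOn P α β
    β′ = swapOn P β α
    factor : Subset n → Vec (Fin n) n → Fin n → Carrier
    factor D m = edgeFactor (lookup D) (lookup m)
    pointwise : ∀ v → factor D₁′ α′ v * factor D₂′ β′ v ≈ factor D₁ α v * factor D₂ β v
    pointwise v with P v in Pv
    ... | true  = ≈-trans (≈-reflexive (cong₂ _*_
                    (edgeFactor-cong (lookup D₁′) (lookup α′) (lookup D₂) (lookup β) v (in₁ v Pv) (swapOn-in P α β v Pv))
                    (edgeFactor-cong (lookup D₂′) (lookup β′) (lookup D₁) (lookup α) v (in₂ v Pv) (swapOn-in P β α v Pv)))) (*-comm _ _)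
    ... | false = ≈-reflexive (cong₂ _*_
                    (edgeFactor-cong (lookup D₁′) (lookup α′) (lookup D₁) (lookup α) v (out₁ v Pv) (swapOn-out P α β v Pv))
                    (edgeFactor-cong (lookup D₂′) (lookup β′) (lookup D₂) (lookup β) v (out₂ v Pv) (swapOn-out P β α v Pv)))

-- Exchange along the path from a

lookup-∅ : {n : ℕ} (v : Fin n) → lookup (∅ {n}) v ≡ false
lookup-∅ v = lookup-replicate v false

∧-true : ∀ x {y} → x ∧ y ≡ true → x ≡ true × y ≡ true
∧-true true {true} _ = refl , refl

module Condensation {r ℓ : Level} (R : CommutativeRing r ℓ) {n : ℕ} (G : WGraph R n) (a : Fin n) where

  open CommutativeRing R using (Carrier; _*_; _≈_; 0#; zeroˡ; zeroʳ)
    renaming (trans to ≈-trans; sym to ≈-sym; reflexive to ≈-reflexive)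
  open RingSums R
  open Σ using (fold)
  open Matchings R G

  Pair : Set
  Pair = Vec (Fin n) n × Vec (Fin n) n

  pairs : List Pair
  pairs = allPairs (allVecs n n) (allVecs n n)

  _≟ₚ_ : DecEq Pair
  _≟ₚ_ = ≡-decˣ (≡-decⱽ _≟ᶠ_) (≡-decⱽ _≟ᶠ_)

  pairs-enumerate : Σ.Enumerates _≟ₚ_ pairs
  pairs-enumerate (μ , ν) =
    Σ.concatMap-enumerates (≡-decⱽ _≟ᶠ_) (≡-decⱽ _≟ᶠ_) _≟ₚ_ (allVecs n n) (allVecs n n)
      (Σ.allVecs-enumerates n n) (Σ.allVecs-enumerates n n) _,_ ,-injective μ ν

  term : Subset n → Vec (Fin n) n → Carrier
  term D m = if isPM G D m then matchWeight R G D m else 0#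

  pairTerm : Subset n → Subset n → Pair → Carrier
  pairTerm D₁ D₂ (μ , ν) = term D₁ μ * term D₂ ν

  M*M≈pairs : ∀ D₁ D₂ → M R G D₁ * M R G D₂ ≈ fold pairs (pairTerm D₁ D₂)
  M*M≈pairs D₁ D₂ = ≈-trans
    (≈-reflexive (cong₂ _*_ (Σ.foldr-map (allVecs n n) (term D₁)) (Σ.foldr-map (allVecs n n) (term D₂))))
    (fold-allPairs (allVecs n n) (allVecs n n) (term D₁) (term D₂))

  pairTerm-notPM : ∀ D₁ D₂ μ ν → isPM G D₁ μ ∧ isPM G D₂ ν ≡ false → pairTerm D₁ D₂ (μ , ν) ≈ 0#
  pairTerm-notPM D₁ D₂ μ ν e with isPM G D₁ μ | isPM G D₂ ν
  ... | false | _     = zeroˡ _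
  ... | true  | false = zeroʳ _

  pairTerm-PM : ∀ D₁ D₂ μ ν → isPM G D₁ μ ≡ true → isPM G D₂ ν ≡ true →
    pairTerm D₁ D₂ (μ , ν) ≡ matchWeight R G D₁ μ * matchWeight R G D₂ ν
  pairTerm-PM D₁ D₂ μ ν pμ pν rewrite pμ | pν = refl

  component : Pair → Fin n → Bool
  component (μ , ν) = Through.onWalk (lookup μ) (lookup ν) a

  endpoint : Pair → Fin n
  endpoint (μ , ν) = partner (lookup μ) (lookup ν) a

  exchange : Pair → Pair
  exchange (μ , ν) = swapOn (component (μ , ν)) μ ν , swapOn (component (μ , ν)) ν μ

  endingAt : Fin n → Subset n → Pair → Carrier
  endingAt x A p = if endpoint p == x then pairTerm ∅ A p else 0#

  endingAt-yes : ∀ x A p → endpoint p ≡ x → endingAt x A p ≡ pairTerm ∅ A p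
  endingAt-yes x A p e rewrite ≡⇒== e = refl

  endingAt-no : ∀ x A p → endpoint p ≢ x → endingAt x A p ≡ 0#
  endingAt-no x A p e rewrite ≢⇒== e = refl

  endingAt-zero : ∀ x A p → (endpoint p ≡ x → pairTerm ∅ A p ≈ 0#) → endingAt x A p ≈ 0#
  endingAt-zero x A p vanishes = by (endpoint p ≟ᶠ x)
    where
    by : Dec (endpoint p ≡ x) → endingAt x A p ≈ 0#
    by (no e≢x)  = ≈-reflexive (endingAt-no x A p e≢x)
    by (yes e≡x) = ≈-trans (≈-reflexive (endingAt-yes x A p e≡x)) (vanishes e≡x)

  module Exchanged (D₁ D₂ : Subset n) (μ ν : Vec (Fin n) n)
    (pμ : isPM G D₁ μ ≡ true) (pν : isPM G D₂ ν ≡ true) (deg : DegreeOne (lookup μ) (lookup ν) a) where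

    private
      module Mμ = PerfectMatching D₁ μ pμ
      module Mν = PerfectMatching D₂ ν pν
      P : Fin n → Bool
      P = component (μ , ν)
      μ′ ν′ : Vec (Fin n) n
      μ′ = proj₁ (exchange (μ , ν))
      ν′ = proj₂ (exchange (μ , ν))
      module T = ThroughProperties (lookup μ) (lookup ν) Mμ.involutive Mν.involutive deg
    open T public using (start-onWalk; end-onWalk)
    open T using (component-closed; component-fixed; module Exchange)
    open Exchange (lookup μ′) (lookup ν′)
      (λ w w∈ → swapOn-in P μ ν w w∈ , swapOn-in P ν μ w w∈)

    μ-closed : ∀ w → P w ≡ true → P (lookup μ w) ≡ true
    μ-closed w = proj₁ ∘ component-closed w

    ν-closed : ∀ w → P w ≡ true → P (lookup ν w) ≡ true
    ν-closed w = proj₂ ∘ component-closed w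

    component-exchange : ∀ w → component (exchange (μ , ν)) w ≡ P w
    component-exchange = onWalk-exchange

    endpoint-exchange : endpoint (exchange (μ , ν)) ≡ endpoint (μ , ν)
    endpoint-exchange = end-exchange

    exchange-involutive : exchange (exchange (μ , ν)) ≡ (μ , ν)
    exchange-involutive = cong₂ _,_ (swapOn-swapOn P (component (μ′ , ν′)) μ ν component-exchange)
                                    (swapOn-swapOn P (component (μ′ , ν′)) ν μ component-exchange)

    deleted-inside : ∀ w → P w ≡ true → lookup D₁ w ≡ true ⊎ lookup D₂ w ≡ true →
      w ≡ a ⊎ w ≡ endpoint (μ , ν)
    deleted-inside w w∈ deleted =
      component-fixed w w∈ (Sum.map (Mμ.deleted⇒fixed w) (Mν.deleted⇒fixed w) deleted)

  -- For a splitting A = S₁ ∪ S₂ with S₁ = {a, x}, exchanging along the path from a is a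
  -- weight-preserving bijection between the pairs of perfect matchings of G and G ∖ A whose path
  -- from a ends at x and the pairs of perfect matchings of G ∖ S₁ and G ∖ S₂, provided the
  -- latter always join a to x.
  module PathsEndingAt (A S₁ S₂ : Subset n) (x : Fin n)
    (S₁-elements : ∀ v → lookup S₁ v ≡ true → v ≡ a ⊎ v ≡ x)
    (a∈S₁ : lookup S₁ a ≡ true) (x∈S₁ : lookup S₁ x ≡ true)
    (partition : ∀ v → lookup A v ≡ lookup S₁ v ∨ lookup S₂ v)
    (disjoint : ∀ v → lookup S₁ v ≡ true → lookup S₂ v ≡ false)
    (joins-a-x : ∀ μ ν → isPM G S₁ μ ≡ true → isPM G S₂ ν ≡ true → endpoint (μ , ν) ≡ x) where

    module Sides (P : Fin n → Bool) (a∈P : P a ≡ true) (x∈P : P x ≡ true)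
      (S₂-outside : ∀ v → P v ≡ true → lookup S₂ v ≡ false) where

      S₁-inside : ∀ v → P v ≡ false → lookup S₁ v ≡ false
      S₁-inside v v∉P with lookup S₁ v in S₁v
      ... | false = refl
      ... | true with S₁-elements v S₁v
      ...   | inj₁ refl = trans (sym a∈P) v∉P
      ...   | inj₂ refl = trans (sym x∈P) v∉P

      A-inside : ∀ v → P v ≡ true → lookup A v ≡ lookup S₁ v
      A-inside v v∈P rewrite partition v | S₂-outside v v∈P = ∨-identityʳ _

      A-outside : ∀ v → P v ≡ false → lookup A v ≡ lookup S₂ v
      A-outside v v∉P rewrite partition v | S₁-inside v v∉P = refl

    isBefore isAfter : Pair → Bool
    isBefore (μ , ν) = isPM G ∅ μ ∧ isPM G A ν ∧ (endpoint (μ , ν) == x)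
    isAfter  (μ , ν) = isPM G S₁ μ ∧ isPM G S₂ ν

    exclusive : ∀ μ → isPM G ∅ μ ≡ true → isPM G S₁ μ ≡ true → ⊥
    exclusive μ p∅ pS₁ = PerfectMatching.kept⇒moved ∅ μ p∅ a (lookup-∅ a)
                           (PerfectMatching.deleted⇒fixed S₁ μ pS₁ a a∈S₁)

    S₂-outside : ∀ D₁ D₂ μ ν (pμ : isPM G D₁ μ ≡ true) (pν : isPM G D₂ ν ≡ true) deg →
      (∀ v → lookup S₂ v ≡ true → lookup D₂ v ≡ true) → endpoint (μ , ν) ≡ x →
      ∀ v → component (μ , ν) v ≡ true → lookup S₂ v ≡ false
    S₂-outside D₁ D₂ μ ν pμ pν deg S₂⊆D₂ ends-at-x v v∈P with lookup S₂ v in S₂v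
    ... | false = refl
    ... | true with Exchanged.deleted-inside D₁ D₂ μ ν pμ pν deg v v∈P (inj₂ (S₂⊆D₂ v S₂v))
    ...   | inj₁ refl  = trans (sym S₂v) (disjoint a a∈S₁)
    ...   | inj₂ v≡end =
      trans (sym S₂v) (disjoint v (subst (λ w → lookup S₁ w ≡ true) (sym (trans v≡end ends-at-x)) x∈S₁))

    module Before (μ ν : Vec (Fin n) n) (before : isBefore (μ , ν) ≡ true) where

      pμ : isPM G ∅ μ ≡ true
      pμ = proj₁ (∧-true (isPM G ∅ μ) before)
      pν : isPM G A ν ≡ true
      pν = proj₁ (∧-true (isPM G A ν) (proj₂ (∧-true (isPM G ∅ μ) before)))
      ends-at-x : endpoint (μ , ν) ≡ x
      ends-at-x = ==⇒≡ (proj₂ (∧-true (isPM G A ν) (proj₂ (∧-true (isPM G ∅ μ) before))))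

      S₂⊆A : ∀ v → lookup S₂ v ≡ true → lookup A v ≡ true
      S₂⊆A v S₂v rewrite partition v | S₂v = ∨-zeroʳ _

      deg : DegreeOne (lookup μ) (lookup ν) a
      deg = inj₁ ( PerfectMatching.deleted⇒fixed A ν pν a (S₁⊆A a a∈S₁)
                 , PerfectMatching.kept⇒moved ∅ μ pμ a (lookup-∅ a))
        where
        S₁⊆A : ∀ v → lookup S₁ v ≡ true → lookup A v ≡ true
        S₁⊆A v S₁v rewrite partition v | S₁v = refl

      open Exchanged ∅ A μ ν pμ pν deg public
      private
        P : Fin n → Bool
        P = component (μ , ν)
        open Sides P start-onWalk (subst (λ w → P w ≡ true) ends-at-x end-onWalk)
                   (S₂-outside ∅ A μ ν pμ pν deg S₂⊆A ends-at-x)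
        S₁-in : ∀ v → P v ≡ true → lookup S₁ v ≡ lookup A v
        S₁-in v v∈P = sym (A-inside v v∈P)
        S₁-out : ∀ v → P v ≡ false → lookup S₁ v ≡ lookup ∅ v
        S₁-out v v∉P = trans (S₁-inside v v∉P) (sym (lookup-∅ v))
        S₂-in : ∀ v → P v ≡ true → lookup S₂ v ≡ lookup ∅ v
        S₂-in v v∈P = trans (S₂-outside ∅ A μ ν pμ pν deg S₂⊆A ends-at-x v v∈P) (sym (lookup-∅ v))
        S₂-out : ∀ v → P v ≡ false → lookup S₂ v ≡ lookup A v
        S₂-out v v∉P = sym (A-outside v v∉P)

      after : isAfter (exchange (μ , ν)) ≡ true
      after rewrite swapOn-isPM ∅ A S₁ μ ν pμ pν P μ-closed ν-closed S₁-in S₁-out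
                  | swapOn-isPM A ∅ S₂ ν μ pν pμ P ν-closed μ-closed S₂-in S₂-out
                  = refl

      exchange-weight : matchWeight R G S₁ (proj₁ (exchange (μ , ν))) * matchWeight R G S₂ (proj₂ (exchange (μ , ν))) ≈
               matchWeight R G ∅ μ * matchWeight R G A ν
      exchange-weight = swapOn-weight ∅ A S₁ S₂ μ ν P S₁-in S₁-out S₂-in S₂-out

    module After (μ ν : Vec (Fin n) n) (after : isAfter (μ , ν) ≡ true) where

      pμ : isPM G S₁ μ ≡ true
      pμ = proj₁ (∧-true (isPM G S₁ μ) after)
      pν : isPM G S₂ ν ≡ true
      pν = proj₂ (∧-true (isPM G S₁ μ) after)

      deg : DegreeOne (lookup μ) (lookup ν) a
      deg = inj₂ ( PerfectMatching.deleted⇒fixed S₁ μ pμ a a∈S₁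
                 , PerfectMatching.kept⇒moved S₂ ν pν a (disjoint a a∈S₁))

      open Exchanged S₁ S₂ μ ν pμ pν deg public
      private
        P : Fin n → Bool
        P = component (μ , ν)
        ends-at-x : endpoint (μ , ν) ≡ x
        ends-at-x = joins-a-x μ ν pμ pν
        S₂∉P : ∀ v → P v ≡ true → lookup S₂ v ≡ false
        S₂∉P = S₂-outside S₁ S₂ μ ν pμ pν deg (λ _ S₂v → S₂v) ends-at-x
        open Sides P start-onWalk (subst (λ w → P w ≡ true) ends-at-x end-onWalk) S₂∉P

      before : isBefore (exchange (μ , ν)) ≡ true
      before
        rewrite swapOn-isPM S₁ S₂ ∅ μ ν pμ pν P μ-closed ν-closed
                  (λ v v∈P → trans (lookup-∅ v) (sym (S₂∉P v v∈P)))
                  (λ v v∉P → trans (lookup-∅ v) (sym (S₁-inside v v∉P)))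
              | swapOn-isPM S₂ S₁ A ν μ pν pμ P ν-closed μ-closed A-inside A-outside
              = ≡⇒== (trans endpoint-exchange ends-at-x)

    before⇒¬after : ∀ p → isBefore p ≡ true → isAfter p ≡ false
    before⇒¬after (μ , ν) b with isPM G S₁ μ in pS₁
    ... | false = refl
    ... | true  = ⊥-elim (exclusive μ (Before.pμ μ ν b) pS₁)

    after⇒¬before : ∀ p → isAfter p ≡ true → isBefore p ≡ false
    after⇒¬before (μ , ν) af with isPM G ∅ μ in p∅
    ... | false = refl
    ... | true  = ⊥-elim (exclusive μ p∅ (After.pμ μ ν af))

    endingAt-0 : ∀ p → isBefore p ≡ false → endingAt x A p ≈ 0#
    endingAt-0 (μ , ν) b = endingAt-zero x A (μ , ν) λ e≡x → pairTerm-notPM ∅ A μ ν (notPM e≡x)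
      where
      notPM : endpoint (μ , ν) ≡ x → isPM G ∅ μ ∧ isPM G A ν ≡ false
      notPM e≡x = trans (sym (∧-identityʳ _))
        (trans (∧-assoc (isPM G ∅ μ) (isPM G A ν) true)
          (trans (cong (λ t → isPM G ∅ μ ∧ isPM G A ν ∧ t) (sym (≡⇒== e≡x))) b))

    switch : Pair → Pair
    switch p = if isBefore p ∨ isAfter p then exchange p else p

    data Kind (p : Pair) : Set where
      before  : isBefore p ≡ true → Kind p
      after   : isAfter p ≡ true → Kind p
      neither : isBefore p ≡ false → isAfter p ≡ false → Kind p

    kind : ∀ p → Kind p
    kind p with isBefore p in b | isAfter p in af
    ... | true  | _     = before b
    ... | false | true  = after af
    ... | false | false = neither b af

    switch-exchange : ∀ p → isBefore p ≡ true ⊎ isAfter p ≡ true → switch p ≡ exchange p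
    switch-exchange p (inj₁ b)  rewrite b = refl
    switch-exchange p (inj₂ af) rewrite af | ∨-zeroʳ (isBefore p) = refl

    switch-neither : ∀ p → isBefore p ≡ false → isAfter p ≡ false → switch p ≡ p
    switch-neither p b af rewrite b | af = refl

    switch-involutive : ∀ p → switch (switch p) ≡ p
    switch-involutive (μ , ν) = by (kind (μ , ν))
      where
      by : Kind (μ , ν) → switch (switch (μ , ν)) ≡ (μ , ν)
      by (before b)  = trans (cong switch (switch-exchange (μ , ν) (inj₁ b)))
                        (trans (switch-exchange (exchange (μ , ν)) (inj₂ (Before.after μ ν b))) (Before.exchange-involutive μ ν b))
      by (after af)  = trans (cong switch (switch-exchange (μ , ν) (inj₂ af)))
                        (trans (switch-exchange (exchange (μ , ν)) (inj₁ (After.before μ ν af))) (After.exchange-involutive μ ν af))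
      by (neither b af) = trans (cong switch (switch-neither (μ , ν) b af)) (switch-neither (μ , ν) b af)

    endingAt≈switch : ∀ p → endingAt x A p ≈ pairTerm S₁ S₂ (switch p)
    endingAt≈switch (μ , ν) = by (kind (μ , ν))
      where
      by : Kind (μ , ν) → endingAt x A (μ , ν) ≈ pairTerm S₁ S₂ (switch (μ , ν))
      by (before b) = begin
        endingAt x A (μ , ν)                           ≡⟨ endingAt-yes x A (μ , ν) B.ends-at-x ⟩
        pairTerm ∅ A (μ , ν)                           ≡⟨ pairTerm-PM ∅ A μ ν B.pμ B.pν ⟩
        matchWeight R G ∅ μ * matchWeight R G A ν      ≈⟨ ≈-sym B.exchange-weight ⟩
        matchWeight R G S₁ μ′ * matchWeight R G S₂ ν′  ≡⟨ sym (pairTerm-PM S₁ S₂ μ′ ν′ (A′.pμ) (A′.pν)) ⟩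
        pairTerm S₁ S₂ (μ′ , ν′)                       ≡⟨ cong (pairTerm S₁ S₂) (sym (switch-exchange (μ , ν) (inj₁ b))) ⟩
        pairTerm S₁ S₂ (switch (μ , ν))                ∎
        where
        open import Relation.Binary.Reasoning.Setoid (CommutativeRing.setoid R)
        module B = Before μ ν b
        μ′ ν′ : Vec (Fin n) n
        μ′ = proj₁ (exchange (μ , ν))
        ν′ = proj₂ (exchange (μ , ν))
        module A′ = After μ′ ν′ B.after
      by (after af) = ≈-trans (endingAt-0 (μ , ν) (after⇒¬before (μ , ν) af)) (≈-sym (≈-trans
        (≈-reflexive (cong (pairTerm S₁ S₂) (switch-exchange (μ , ν) (inj₂ af))))
        (pairTerm-notPM S₁ S₂ (proj₁ (exchange (μ , ν))) (proj₂ (exchange (μ , ν)))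
          (before⇒¬after (exchange (μ , ν)) (After.before μ ν af)))))
      by (neither b af) = ≈-trans (endingAt-0 (μ , ν) b) (≈-sym (≈-trans
        (≈-reflexive (cong (pairTerm S₁ S₂) (switch-neither (μ , ν) b af)))
        (pairTerm-notPM S₁ S₂ μ ν af)))

    sum-endingAt : fold pairs (endingAt x A) ≈ M R G S₁ * M R G S₂
    sum-endingAt = ≈-trans (Σ.fold-cong pairs endingAt≈switch)
      (≈-trans (Σ.fold-involution _≟ₚ_ pairs pairs-enumerate switch switch-involutive (pairTerm S₁ S₂))
               (≈-sym (M*M≈pairs S₁ S₂)))

-- Where the path from a ends

module _ {n : ℕ} where

  lookup-∪ : ∀ (S T : Subset n) v → lookup (S ∪ T) v ≡ lookup S v ∨ lookup T v
  lookup-∪ S T v = lookup-zipWith _∨_ v S T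

  ⁅⁆-self : ∀ (p : Fin n) → lookup ⁅ p ⁆ p ≡ true
  ⁅⁆-self p = []=⇒lookup (x∈⁅x⁆ p)

  ⁅⁆-true : ∀ {p v : Fin n} → lookup ⁅ p ⁆ v ≡ true → v ≡ p
  ⁅⁆-true {p} {v} e = x∈⁅y⁆⇒x≡y p (lookup⇒[]= v ⁅ p ⁆ e)

  ⁅⁆-other : ∀ {p v : Fin n} → v ≢ p → lookup ⁅ p ⁆ v ≡ false
  ⁅⁆-other {p} {v} v≢p with lookup ⁅ p ⁆ v in e
  ... | false = refl
  ... | true  = ⊥-elim (v≢p (⁅⁆-true e))

  pair-elements : ∀ (p q : Fin n) {v} → lookup (⁅ p ⁆ ∪ ⁅ q ⁆) v ≡ true → v ≡ p ⊎ v ≡ q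
  pair-elements p q {v} e rewrite lookup-∪ ⁅ p ⁆ ⁅ q ⁆ v with lookup ⁅ p ⁆ v in ep
  ... | true  = inj₁ (⁅⁆-true ep)
  ... | false = inj₂ (⁅⁆-true e)

  pair-left : ∀ (p q : Fin n) → lookup (⁅ p ⁆ ∪ ⁅ q ⁆) p ≡ true
  pair-left p q rewrite lookup-∪ ⁅ p ⁆ ⁅ q ⁆ p | ⁅⁆-self p = refl

  pair-right : ∀ (p q : Fin n) → lookup (⁅ p ⁆ ∪ ⁅ q ⁆) q ≡ true
  pair-right p q rewrite lookup-∪ ⁅ p ⁆ ⁅ q ⁆ q | ⁅⁆-self q = ∨-comm _ true

  pair-outside : ∀ {p q v : Fin n} → v ≢ p → v ≢ q → lookup (⁅ p ⁆ ∪ ⁅ q ⁆) v ≡ false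
  pair-outside {p} {q} {v} v≢p v≢q rewrite lookup-∪ ⁅ p ⁆ ⁅ q ⁆ v | ⁅⁆-other v≢p | ⁅⁆-other v≢q = refl

  pairs-disjoint : ∀ {p q r s : Fin n} → p ≢ r → p ≢ s → q ≢ r → q ≢ s →
    ∀ v → lookup (⁅ p ⁆ ∪ ⁅ q ⁆) v ≡ true → lookup (⁅ r ⁆ ∪ ⁅ s ⁆) v ≡ false
  pairs-disjoint {p} {q} p≢r p≢s q≢r q≢s v e with pair-elements p q e
  ... | inj₁ refl = pair-outside p≢r p≢s
  ... | inj₂ refl = pair-outside q≢r q≢s

∣pair∣≡2 : ∀ {n} (p q : Fin n) → p ≢ q → ∣ ⁅ p ⁆ ∪ ⁅ q ⁆ ∣ ≡ 2
∣pair∣≡2 zero    zero    p≢q = ⊥-elim (p≢q refl)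
∣pair∣≡2 zero    (suc q) _   = cong suc (trans (cong ∣_∣ (∪-identityˡ ⁅ q ⁆)) (∣⁅x⁆∣≡1 q))
∣pair∣≡2 (suc p) zero    _   = cong suc (trans (cong ∣_∣ (∪-identityʳ ⁅ p ⁆)) (∣⁅x⁆∣≡1 p))
∣pair∣≡2 (suc p) (suc q) p≢q = ∣pair∣≡2 p q (p≢q ∘ cong suc)

pairing-of-four : ∀ {n} (π : Fin n → Fin n) {a x y z : Fin n} → a ≢ y → y ≢ z →
  π a ≡ x ⊎ π a ≡ y ⊎ π a ≡ z → π y ≡ a ⊎ π y ≡ x ⊎ π y ≡ z →
  π (π a) ≡ a → π (π y) ≡ y → π a ≢ y → π a ≢ z ⊎ π y ≢ x → π a ≡ x
pairing-of-four π a≢y y≢z (inj₁ πa≡x)          _ _ _ _ _ = πa≡x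
pairing-of-four π a≢y y≢z (inj₂ (inj₁ πa≡y))   _ _ _ πa≢y _ = ⊥-elim (πa≢y πa≡y)
pairing-of-four π a≢y y≢z (inj₂ (inj₂ πa≡z)) _ _ _ _ (inj₁ πa≢z) = ⊥-elim (πa≢z πa≡z)
pairing-of-four π a≢y y≢z (inj₂ (inj₂ πa≡z)) πy ππa ππy _ (inj₂ πy≢x) with πy
... | inj₁ πy≡a        = ⊥-elim (y≢z (trans (sym ππy) (trans (cong π πy≡a) πa≡z)))
... | inj₂ (inj₁ πy≡x) = ⊥-elim (πy≢x πy≡x)
... | inj₂ (inj₂ πy≡z) = ⊥-elim (a≢y (trans (sym ππa) (trans (cong π πa≡z) (trans (cong π (sym πy≡z)) ππy))))

OddPaths : {n : ℕ} → Vec (Fin n) n → Vec (Fin n) n → Fin n → Fin n → Set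
OddPaths {n} μ ν u w = ∀ k (p : Vec (Fin n) (suc k)) → SupPath μ ν u w k p → Odd k

module Pairing {r ℓ : Level} (R : CommutativeRing r ℓ) {n : ℕ} (G : WGraph R n) (a x y z : Fin n)
  (a≢x : a ≢ x) (a≢y : a ≢ y) (a≢z : a ≢ z) (x≢y : x ≢ y) (x≢z : x ≢ z) (y≢z : y ≢ z)
  (μ ν : Vec (Fin n) n) (pμ : isPM G (⁅ a ⁆ ∪ ⁅ x ⁆) μ ≡ true) (pν : isPM G (⁅ y ⁆ ∪ ⁅ z ⁆) ν ≡ true) where

  open Matchings R G
  private
    S₁ S₂ : Subset n
    S₁ = ⁅ a ⁆ ∪ ⁅ x ⁆
    S₂ = ⁅ y ⁆ ∪ ⁅ z ⁆
    module Mμ = PerfectMatching S₁ μ pμ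
    module Mν = PerfectMatching S₂ ν pν

    π : Fin n → Fin n
    π = partner (lookup μ) (lookup ν)

    Side : Fin n → Set
    Side v = lookup S₁ v ≡ true ⊎ lookup S₂ v ≡ true

    S₁⇒¬S₂ : ∀ v → lookup S₁ v ≡ true → lookup S₂ v ≡ false
    S₁⇒¬S₂ = pairs-disjoint a≢y a≢z x≢y x≢z

    S₂⇒¬S₁ : ∀ v → lookup S₂ v ≡ true → lookup S₁ v ≡ false
    S₂⇒¬S₁ = pairs-disjoint (a≢y ∘ sym) (x≢y ∘ sym) (a≢z ∘ sym) (x≢z ∘ sym)

    degreeOne : ∀ {v} → Side v → DegreeOne (lookup μ) (lookup ν) v
    degreeOne (inj₁ S₁v) = inj₂ (Mμ.deleted⇒fixed _ S₁v , Mν.kept⇒moved _ (S₁⇒¬S₂ _ S₁v))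
    degreeOne (inj₂ S₂v) = inj₁ (Mν.deleted⇒fixed _ S₂v , Mμ.kept⇒moved _ (S₂⇒¬S₁ _ S₂v))

    module Facts {v} (s : Side v) =
      PartnerFacts (partner-facts (lookup μ) (lookup ν) Mμ.involutive Mν.involutive (degreeOne s))

    π-side : ∀ {v} → Side v → Side (π v)
    π-side s with Facts.degreeOne s
    ... | inj₁ (νw≡w , _) = inj₂ (Mν.fixed⇒deleted _ νw≡w)
    ... | inj₂ (μw≡w , _) = inj₁ (Mμ.fixed⇒deleted _ μw≡w)

    -- A path between the two sides starts and ends with edges of different matchings, so it
    -- has even length.
    separated : ∀ {u w} → Side u → FixedByDifferent (lookup μ) (lookup ν) u w → OddPaths μ ν u w → π u ≢ w
    separated {u} s different sep refl =
      case trans (sym (even different)) (isEven-odd length (sep length vertices isPath)) of λ ()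
      where open Facts s

    a∈S₁ : lookup S₁ a ≡ true
    a∈S₁ = pair-left a x
    x∈S₁ : lookup S₁ x ≡ true
    x∈S₁ = pair-right a x
    y∈S₂ : lookup S₂ y ≡ true
    y∈S₂ = pair-left y z
    z∈S₂ : lookup S₂ z ≡ true
    z∈S₂ = pair-right y z

  partner-of-a : OddPaths μ ν a y → OddPaths μ ν a z ⊎ OddPaths μ ν x y ⊎ OddPaths μ ν y x →
    partner (lookup μ) (lookup ν) a ≡ x
  partner-of-a sep-ay second-sep =
    pairing-of-four π a≢y y≢z πa-cases πy-cases (Facts.involutive (inj₁ a∈S₁)) (Facts.involutive (inj₂ y∈S₂))
      (separated (inj₁ a∈S₁) (inj₂ (Mμ.deleted⇒fixed a a∈S₁ , Mν.deleted⇒fixed y y∈S₂)) sep-ay) second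
    where
    πa-cases : π a ≡ x ⊎ π a ≡ y ⊎ π a ≡ z
    πa-cases with π-side (inj₁ a∈S₁)
    ... | inj₁ e with pair-elements a x e
    ...   | inj₁ πa≡a = ⊥-elim (Facts.moves (inj₁ a∈S₁) πa≡a)
    ...   | inj₂ πa≡x = inj₁ πa≡x
    πa-cases | inj₂ e = inj₂ (pair-elements y z e)
    πy-cases : π y ≡ a ⊎ π y ≡ x ⊎ π y ≡ z
    πy-cases with π-side (inj₂ y∈S₂)
    ... | inj₁ e = Sum.map₂ inj₁ (pair-elements a x e)
    ... | inj₂ e with pair-elements y z e
    ...   | inj₁ πy≡y = ⊥-elim (Facts.moves (inj₂ y∈S₂) πy≡y)
    ...   | inj₂ πy≡z = inj₂ (inj₂ πy≡z)
    second : π a ≢ z ⊎ π y ≢ x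
    second = from second-sep
      where
      from : OddPaths μ ν a z ⊎ OddPaths μ ν x y ⊎ OddPaths μ ν y x → π a ≢ z ⊎ π y ≢ x
      from (inj₁ sep-az) = inj₁ (separated (inj₁ a∈S₁) (inj₂ (Mμ.deleted⇒fixed a a∈S₁ , Mν.deleted⇒fixed z z∈S₂)) sep-az)
      from (inj₂ (inj₁ sep-xy)) = inj₂ λ πy≡x →
        separated (inj₁ x∈S₁) (inj₂ (Mμ.deleted⇒fixed x x∈S₁ , Mν.deleted⇒fixed y y∈S₂)) sep-xy
          (trans (cong π (sym πy≡x)) (Facts.involutive (inj₂ y∈S₂)))
      from (inj₂ (inj₂ sep-yx)) = inj₂ (separated (inj₂ y∈S₂) (inj₁ (Mν.deleted⇒fixed y y∈S₂ , Mμ.deleted⇒fixed x x∈S₁)) sep-yx)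

-- Kuo condensation

module KuoCondensation {r ℓ : Level} (R : CommutativeRing r ℓ) {n : ℕ} (G : WGraph R n) (a b c d : Fin n)
  (a≢b : a ≢ b) (a≢c : a ≢ c) (a≢d : a ≢ d) (b≢c : b ≢ c) (b≢d : b ≢ d) (c≢d : c ≢ d) where

  open CommutativeRing R using (_≈_; _+_; _*_; 0#; +-cong; +-congʳ; +-identityʳ; +-identityˡ)
    renaming (trans to ≈-trans; sym to ≈-sym)
  open RingSums R
  open Σ using (fold)
  open Matchings R G
  open Condensation R G a

  A : Subset n
  A = ⁅ a ⁆ ∪ ⁅ b ⁆ ∪ ⁅ c ⁆ ∪ ⁅ d ⁆

  Hypothesis : Set
  Hypothesis = ∀ (S : Subset n) → S ⊆ A → ∣ S ∣ ≡ 2 → ∀ (μ ν : Vec (Fin n) n) →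
    isPM G S μ ≡ true → isPM G (A ∩ ∁ S) ν ≡ true → ∀ (u w : Fin n) →
    ((u ≡ a × w ≡ b) ⊎ (u ≡ a × w ≡ c) ⊎ (u ≡ b × w ≡ c)) → OddPaths μ ν u w

  lookup-A : ∀ v → lookup A v ≡ lookup ⁅ a ⁆ v ∨ (lookup ⁅ b ⁆ v ∨ (lookup ⁅ c ⁆ v ∨ lookup ⁅ d ⁆ v))
  lookup-A v rewrite lookup-∪ ⁅ a ⁆ (⁅ b ⁆ ∪ ⁅ c ⁆ ∪ ⁅ d ⁆) v | lookup-∪ ⁅ b ⁆ (⁅ c ⁆ ∪ ⁅ d ⁆) v
                   | lookup-∪ ⁅ c ⁆ ⁅ d ⁆ v = refl

  A-elements : ∀ {v} → lookup A v ≡ true → v ≡ a ⊎ v ≡ b ⊎ v ≡ c ⊎ v ≡ d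
  A-elements {v} e rewrite lookup-A v
    with lookup ⁅ a ⁆ v in ea | lookup ⁅ b ⁆ v in eb | lookup ⁅ c ⁆ v in ec
  ... | true  | _     | _     = inj₁ (⁅⁆-true ea)
  ... | false | true  | _     = inj₂ (inj₁ (⁅⁆-true eb))
  ... | false | false | true  = inj₂ (inj₂ (inj₁ (⁅⁆-true ec)))
  ... | false | false | false = inj₂ (inj₂ (inj₂ (⁅⁆-true e)))

  partition-by : ∀ x y z →
    (∀ v → lookup ⁅ a ⁆ v ∨ (lookup ⁅ b ⁆ v ∨ (lookup ⁅ c ⁆ v ∨ lookup ⁅ d ⁆ v)) ≡
           (lookup ⁅ a ⁆ v ∨ lookup ⁅ x ⁆ v) ∨ (lookup ⁅ y ⁆ v ∨ lookup ⁅ z ⁆ v)) →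
    ∀ v → lookup A v ≡ lookup (⁅ a ⁆ ∪ ⁅ x ⁆) v ∨ lookup (⁅ y ⁆ ∪ ⁅ z ⁆) v
  partition-by x y z regroup v =
    trans (lookup-A v) (trans (regroup v) (sym (cong₂ _∨_ (lookup-∪ ⁅ a ⁆ ⁅ x ⁆ v) (lookup-∪ ⁅ y ⁆ ⁅ z ⁆ v))))

  module Splitting (H : Hypothesis) (x y z : Fin n)
    (a≢x : a ≢ x) (a≢y : a ≢ y) (a≢z : a ≢ z) (x≢y : x ≢ y) (x≢z : x ≢ z) (y≢z : y ≢ z)
    (partition : ∀ v → lookup A v ≡ lookup (⁅ a ⁆ ∪ ⁅ x ⁆) v ∨ lookup (⁅ y ⁆ ∪ ⁅ z ⁆) v)
    (separations : ∀ μ ν → (∀ u w → (u ≡ a × w ≡ b) ⊎ (u ≡ a × w ≡ c) ⊎ (u ≡ b × w ≡ c) → OddPaths μ ν u w) →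
      OddPaths μ ν a y × (OddPaths μ ν a z ⊎ OddPaths μ ν x y ⊎ OddPaths μ ν y x)) where

    private
      S₁ S₂ : Subset n
      S₁ = ⁅ a ⁆ ∪ ⁅ x ⁆
      S₂ = ⁅ y ⁆ ∪ ⁅ z ⁆

      disjoint : ∀ v → lookup S₁ v ≡ true → lookup S₂ v ≡ false
      disjoint = pairs-disjoint a≢y a≢z x≢y x≢z

      S₁⊆A : S₁ ⊆ A
      S₁⊆A {v} v∈S₁ = lookup⇒[]= v A (trans (partition v) (cong (_∨ lookup S₂ v) ([]=⇒lookup v∈S₁)))

      complement : A ∩ ∁ S₁ ≡ S₂
      complement = Pointwise-≡⇒≡ (ext pointwise)
        where
        pointwise : ∀ v → lookup (A ∩ ∁ S₁) v ≡ lookup S₂ v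
        pointwise v = begin
          lookup (A ∩ ∁ S₁) v                             ≡⟨ lookup-zipWith _∧_ v A (∁ S₁) ⟩
          lookup A v ∧ lookup (∁ S₁) v                    ≡⟨ cong₂ _∧_ (partition v) (lookup-map v not S₁) ⟩
          (lookup S₁ v ∨ lookup S₂ v) ∧ not (lookup S₁ v) ≡⟨ outside (lookup S₁ v) refl ⟩
          lookup S₂ v                                     ∎
          where
          open ≡-Reasoning
          outside : ∀ s → lookup S₁ v ≡ s → (s ∨ lookup S₂ v) ∧ not s ≡ lookup S₂ v
          outside true  S₁v = sym (disjoint v S₁v)
          outside false _   = ∧-identityʳ _

      joins-a-x : ∀ μ ν → isPM G S₁ μ ≡ true → isPM G S₂ ν ≡ true → endpoint (μ , ν) ≡ x
      joins-a-x μ ν pμ pν =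
        let sep-ay , second = separations μ ν
              (H S₁ S₁⊆A (∣pair∣≡2 a x a≢x) μ ν pμ (subst (λ D → isPM G D ν ≡ true) (sym complement) pν))
        in Pairing.partner-of-a R G a x y z a≢x a≢y a≢z x≢y x≢z y≢z μ ν pμ pν sep-ay second

    open PathsEndingAt A S₁ S₂ x (λ _ → pair-elements a x) (pair-left a x) (pair-right a x) partition disjoint joins-a-x
      public using (sum-endingAt)

  endpoint-in-A : ∀ μ ν → isPM G ∅ μ ≡ true → isPM G A ν ≡ true →
    endpoint (μ , ν) ≡ b ⊎ endpoint (μ , ν) ≡ c ⊎ endpoint (μ , ν) ≡ d
  endpoint-in-A μ ν pμ pν = from degreeOne
    where
    module Mμ = PerfectMatching ∅ μ pμ
    module Mν = PerfectMatching A ν pν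
    a∈A : lookup A a ≡ true
    a∈A rewrite lookup-A a | ⁅⁆-self a = refl
    open PartnerFacts (partner-facts (lookup μ) (lookup ν) Mμ.involutive Mν.involutive
                        (inj₁ (Mν.deleted⇒fixed a a∈A , Mμ.kept⇒moved a (lookup-∅ a))))
    from : DegreeOne (lookup μ) (lookup ν) (endpoint (μ , ν)) →
      endpoint (μ , ν) ≡ b ⊎ endpoint (μ , ν) ≡ c ⊎ endpoint (μ , ν) ≡ d
    from (inj₂ (μe≡e , _)) = case trans (sym (Mμ.fixed⇒deleted _ μe≡e)) (lookup-∅ (endpoint (μ , ν))) of λ ()
    from (inj₁ (νe≡e , _)) with A-elements (Mν.fixed⇒deleted _ νe≡e)
    ... | inj₁ e≡a = ⊥-elim (moves e≡a)
    ... | inj₂ e∈bcd = e∈bcd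

  split : ∀ p → pairTerm ∅ A p ≈ (endingAt b A p + endingAt c A p) + endingAt d A p
  split (μ , ν) = by (isPM G ∅ μ) (isPM G A ν) refl refl
    where
    p : Pair
    p = (μ , ν)
    vanishing : pairTerm ∅ A p ≈ 0# → pairTerm ∅ A p ≈ (endingAt b A p + endingAt c A p) + endingAt d A p
    vanishing t≈0 = ≈-trans t≈0 (≈-sym (≈-trans
      (+-cong (+-cong (endingAt-zero b A p λ _ → t≈0) (endingAt-zero c A p λ _ → t≈0))
              (endingAt-zero d A p λ _ → t≈0))
      (≈-trans (+-identityʳ _) (+-identityʳ _))))
    by : ∀ b₁ b₂ → isPM G ∅ μ ≡ b₁ → isPM G A ν ≡ b₂ →
      pairTerm ∅ A p ≈ (endingAt b A p + endingAt c A p) + endingAt d A p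
    by true true p∅ pA with endpoint-in-A μ ν p∅ pA
    ... | inj₁ e≡b
      rewrite endingAt-yes b A p e≡b | endingAt-no c A p (b≢c ∘ trans (sym e≡b))
            | endingAt-no d A p (b≢d ∘ trans (sym e≡b))
      = ≈-sym (≈-trans (+-identityʳ _) (+-identityʳ _))
    ... | inj₂ (inj₁ e≡c)
      rewrite endingAt-no b A p ((b≢c ∘ sym) ∘ trans (sym e≡c)) | endingAt-yes c A p e≡c
            | endingAt-no d A p (c≢d ∘ trans (sym e≡c))
      = ≈-sym (≈-trans (+-identityʳ _) (+-identityˡ _))
    ... | inj₂ (inj₂ e≡d)
      rewrite endingAt-no b A p ((b≢d ∘ sym) ∘ trans (sym e≡d)) | endingAt-no c A p ((c≢d ∘ sym) ∘ trans (sym e≡d))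
            | endingAt-yes d A p e≡d
      = ≈-sym (≈-trans (+-congʳ (+-identityʳ _)) (+-identityˡ _))
    by false _    p∅ _  = vanishing (pairTerm-notPM ∅ A μ ν (cong (_∧ isPM G A ν) p∅))
    by true false p∅ pA = vanishing (pairTerm-notPM ∅ A μ ν (cong₂ _∧_ p∅ pA))

  condensation : Hypothesis →
    M R G ∅ * M R G A ≈
    ((M R G (⁅ a ⁆ ∪ ⁅ b ⁆) * M R G (⁅ c ⁆ ∪ ⁅ d ⁆)) + (M R G (⁅ a ⁆ ∪ ⁅ c ⁆) * M R G (⁅ b ⁆ ∪ ⁅ d ⁆)))
      + (M R G (⁅ a ⁆ ∪ ⁅ d ⁆) * M R G (⁅ b ⁆ ∪ ⁅ c ⁆))
  condensation H = begin
    M R G ∅ * M R G A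
      ≈⟨ M*M≈pairs ∅ A ⟩
    fold pairs (pairTerm ∅ A)
      ≈⟨ Σ.fold-cong pairs split ⟩
    fold pairs (λ p → (endingAt b A p + endingAt c A p) + endingAt d A p)
      ≈⟨ ≈-trans (Σ.fold-∙ pairs _ (endingAt d A)) (+-congʳ (Σ.fold-∙ pairs (endingAt b A) (endingAt c A))) ⟩
    (fold pairs (endingAt b A) + fold pairs (endingAt c A)) + fold pairs (endingAt d A)
      ≈⟨ +-cong (+-cong B.sum-endingAt C.sum-endingAt) D.sum-endingAt ⟩
    ((M R G (⁅ a ⁆ ∪ ⁅ b ⁆) * M R G (⁅ c ⁆ ∪ ⁅ d ⁆)) + (M R G (⁅ a ⁆ ∪ ⁅ c ⁆) * M R G (⁅ b ⁆ ∪ ⁅ d ⁆)))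
      + (M R G (⁅ a ⁆ ∪ ⁅ d ⁆) * M R G (⁅ b ⁆ ∪ ⁅ c ⁆)) ∎
    where
    open import Relation.Binary.Reasoning.Setoid (CommutativeRing.setoid R)
    is : Fin n → Fin n → Bool
    is u v = lookup ⁅ u ⁆ v
    module B = Splitting H b c d a≢b a≢c a≢d b≢c b≢d c≢d
      (partition-by b c d λ v → sym (∨-assoc (is a v) (is b v) _))
      (λ μ ν s → s a c (inj₂ (inj₁ (refl , refl))) , inj₂ (inj₁ (s b c (inj₂ (inj₂ (refl , refl))))))
    module C = Splitting H c b d a≢c a≢b a≢d (b≢c ∘ sym) c≢d b≢d
      (partition-by c b d λ v → trans (sym (∨-assoc (is a v) (is b v) _)) (∨-interchange (is a v) (is b v) (is c v) (is d v)))
      (λ μ ν s → s a b (inj₁ (refl , refl)) , inj₂ (inj₂ (s b c (inj₂ (inj₂ (refl , refl))))))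
    module D = Splitting H d b c a≢d a≢b a≢c (b≢d ∘ sym) (c≢d ∘ sym) b≢c
      (partition-by d b c λ v → trans (sym (∨-assoc (is a v) (is b v) _))
        (trans (cong ((is a v ∨ is b v) ∨_) (∨-comm (is c v) (is d v))) (∨-interchange (is a v) (is b v) (is d v) (is c v))))
      (λ μ ν s → s a b (inj₁ (refl , refl)) , inj₁ (s a c (inj₂ (inj₁ (refl , refl)))))

theorem1 : {r ℓ : Level} (R : CommutativeRing r ℓ) {n : ℕ} (G : WGraph R n)
    (a b c d : Fin n) →
    a ≢ b → a ≢ c → a ≢ d → b ≢ c → b ≢ d → c ≢ d →
    (∀ (S : Subset n) → S ⊆ (⁅ a ⁆ ∪ ⁅ b ⁆ ∪ ⁅ c ⁆ ∪ ⁅ d ⁆) → ∣ S ∣ ≡ 2 →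
      ∀ (μ ν : Vec (Fin n) n) →
      isPM G S μ ≡ true →
      isPM G ((⁅ a ⁆ ∪ ⁅ b ⁆ ∪ ⁅ c ⁆ ∪ ⁅ d ⁆) ∩ ∁ S) ν ≡ true →
      ∀ (x y : Fin n) →
      ((x ≡ a × y ≡ b) ⊎ (x ≡ a × y ≡ c) ⊎ (x ≡ b × y ≡ c)) →
      ∀ (k : ℕ) (p : Vec (Fin n) (suc k)) → SupPath μ ν x y k p → Odd k) →
    CommutativeRing._≈_ R
      (CommutativeRing._*_ R (M R G ∅) (M R G (⁅ a ⁆ ∪ ⁅ b ⁆ ∪ ⁅ c ⁆ ∪ ⁅ d ⁆)))
      (CommutativeRing._+_ R
        (CommutativeRing._+_ R
          (CommutativeRing._*_ R (M R G (⁅ a ⁆ ∪ ⁅ b ⁆)) (M R G (⁅ c ⁆ ∪ ⁅ d ⁆)))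
          (CommutativeRing._*_ R (M R G (⁅ a ⁆ ∪ ⁅ c ⁆)) (M R G (⁅ b ⁆ ∪ ⁅ d ⁆))))
        (CommutativeRing._*_ R (M R G (⁅ a ⁆ ∪ ⁅ d ⁆)) (M R G (⁅ b ⁆ ∪ ⁅ c ⁆))))
theorem1 R G a b c d a≢b a≢c a≢d b≢c b≢d c≢d H =
  KuoCondensation.condensation R G a b c d a≢b a≢c a≢d b≢c b≢d c≢d H
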